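{- Let $T$ be a tree. Then some cycle arising as a product of the edge-transpositions of $T$ (over an ordering of all edges) has multiplicity $1$ if and only if $T$ is a caterpillar.
   Context: Each edge $\{i,j\}$ is regarded as the transposition $(i,j)$; an ordering lists every edge exactly once. The multiplicity of a cycle $c$ is the number of orderings whose product is $c$. A caterpillar is a tree with the property that removing all its leaves (vertices of degree 1, with their edges) gives a path. -}

module Defs where

open import Data.Nat using (ℕ; zero; suc; _≤_)
open import Data.Fin using (Fin; _≟_)
open import Data.Fin.Permutation.Components using (transpose)
open import Data.Product using (_×_; _,_; Σ; ∃; ∃-syntax; proj₁; proj₂)
open import Data.Sum using (_⊎_)
open import Data.Bool using (if_then_else_; _∨_)
open import Data.List using (List; []; _∷_; _++_; _∷ʳ_; length)
open import Data.List.Membership.Propositional using (_∈_)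
open import Data.List.Relation.Unary.AllPairs using (AllPairs)
open import Data.List.Relation.Unary.All using (All)
open import Data.List.Relation.Unary.Unique.Propositional using (Unique)
open import Data.List.Relation.Unary.Linked using (Linked)
open import Data.List.Relation.Binary.Permutation.Propositional using (_↭_)
open import Relation.Binary.PropositionalEquality using (_≡_; _≢_)
open import Relation.Binary.Construct.Closure.ReflexiveTransitive using (Star)
open import Relation.Nullary using (¬_; ⌊_⌋)
open import Function using (id; _∘_)
open import Function.Bundles using (_⇔_)

-- A (simple) graph on the vertex set Fin n is given by its list of edges;
-- an edge {u,v} is stored as an (oriented, but orientation is irrelevant) pair.
Edge : ℕ → Set
Edge n = Fin n × Fin n

SameEdge : ∀ {n} → Edge n → Edge n → Set
SameEdge (a , b) (c , d) = (a ≡ c × b ≡ d) ⊎ (a ≡ d × b ≡ c)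

IsSimple : ∀ {n} → List (Edge n) → Set
IsSimple E = All (λ e → proj₁ e ≢ proj₂ e) E × AllPairs (λ e f → ¬ SameEdge e f) E

Adj : ∀ {n} → List (Edge n) → Fin n → Fin n → Set
Adj E u v = (u , v) ∈ E ⊎ (v , u) ∈ E

Connected : ∀ {n} → List (Edge n) → Set
Connected {n} E = (u v : Fin n) → Star (Adj E) u v

HasCycle : ∀ {n} → List (Edge n) → Set
HasCycle {n} E = Σ (Fin n) λ x → Σ (List (Fin n)) λ ys →
  2 ≤ length ys × Unique (x ∷ ys) × Linked (Adj E) ((x ∷ ys) ∷ʳ x)

IsTree : ∀ {n} → List (Edge n) → Set
IsTree E = IsSimple E × Connected E × ¬ HasCycle E

degree : ∀ {n} → List (Edge n) → Fin n → ℕ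
degree [] v = 0
degree ((a , b) ∷ E) v =
  if ⌊ a ≟ v ⌋ ∨ ⌊ b ≟ v ⌋ then suc (degree E v) else degree E v

IsLeaf : ∀ {n} → List (Edge n) → Fin n → Set
IsLeaf E v = degree E v ≡ 1

Consecutive : ∀ {n} → List (Fin n) → Fin n → Fin n → Set
Consecutive P u v = ∃[ xs ] ∃[ ys ] (P ≡ xs ++ u ∷ v ∷ ys ⊎ P ≡ xs ++ v ∷ u ∷ ys)

-- Caterpillar: the graph obtained by deleting all leaves is a path, i.e. there
-- is a list P of distinct vertices, listing exactly the non-leaf vertices, such
-- that two non-leaf vertices are adjacent iff they are consecutive in P.
IsCaterpillar : ∀ {n} → List (Edge n) → Set
IsCaterpillar {n} E = Σ (List (Fin n)) λ P →
  Unique P ×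
  ((v : Fin n) → (v ∈ P) ⇔ (¬ IsLeaf E v)) ×
  ((u v : Fin n) → ¬ IsLeaf E u → ¬ IsLeaf E v → Adj E u v ⇔ Consecutive P u v)

-- product of the transpositions of an ordering of edges (leftmost applied last)
product : ∀ {n} → List (Edge n) → Fin n → Fin n
product [] = id
product ((a , b) ∷ O) = transpose a b ∘ product O

IsOrdering : ∀ {n} → List (Edge n) → List (Edge n) → Set
IsOrdering E O = O ↭ E

iter : ∀ {n} → (Fin n → Fin n) → ℕ → Fin n → Fin n
iter c zero = id
iter c (suc k) = c ∘ iter c k

IsCycle : ∀ {n} → (Fin n → Fin n) → Set
IsCycle {n} c = Σ (Fin n) λ x → (y : Fin n) → c y ≢ y → ∃[ k ] iter c k x ≡ y

MultiplicityOne : ∀ {n} → List (Edge n) → (Fin n → Fin n) → Set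
MultiplicityOne E c = Σ (List (Edge _)) λ O → IsOrdering E O ×
  (∀ x → product O x ≡ c x) ×
  ((O′ : List (Edge _)) → IsOrdering E O′ → (∀ x → product O′ x ≡ c x) → O′ ≡ O)

-- An ordering whose product has multiplicity one must be a chain: if two consecutive edges
-- were disjoint, their transpositions would commute and swapping them would give a second
-- ordering with the same product. Conversely, in a forest a chain is the only ordering with its
-- product: if e = vw opens the chain, the first edge g = vw′ at v of another ordering with the
-- same product must be e, since otherwise the common preimage of v would lead back to w and to
-- w′ by walks avoiding v, closing a cycle; the edges before g commute past it. Any ordering of a
-- tree multiplies to a single cycle, each transposition merging the orbits of its two ends.
-- So the theorem reduces to: a tree has a chain ordering iff it is a caterpillar. In a chain of
-- a tree the edges at each vertex form a contiguous block, so the common vertices of consecutive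
-- edges, with repetitions merged, list the spine in order; and sorting the edges of a
-- caterpillar along its spine, each spine edge placed between the legs at its two ends, gives a
-- chain.

module Submission where

open import Defs

open import Data.Empty using (⊥; ⊥-elim)
open import Data.Fin using (Fin; zero; _≟_; toℕ)
open import Data.Fin.Permutation.Components using (transpose)
open import Data.Fin.Properties using (pigeonhole)
open import Data.List using (List; []; _∷_; _++_; _∷ʳ_; reverse; length; filter; derun)
open import Data.List.Membership.Propositional using (_∈_; _∉_; lose)
open import Data.List.Membership.Propositional.Properties
  using (∈-insert; ∈-++⁺ˡ; ∈-++⁺ʳ; ∈-++⁻; ∈-∃++; ∈-length; ∈-filter⁺; ∈-filter⁻; ∈-derun⁺; ∈-derun⁻)
open import Data.List.Properties
  using (++-assoc; ∷-injective; ∷-injectiveˡ; ∷-injectiveʳ; ∷ʳ-injectiveʳ; reverse-involutive; unfold-reverse;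
         length-++; filter-++; filter-accept; derun-accept)
open import Data.List.Relation.Binary.Permutation.Propositional
  using (_↭_; ↭-refl; ↭-prep; ↭-swap; ↭-sym; ↭-trans; ↭⇒↭ₛ)
open import Data.List.Relation.Binary.Permutation.Propositional.Properties
  using (All-resp-↭; ∈-resp-↭; ↭-empty-inv; drop-mid; ↭-length; filter-↭)
import Data.List.Relation.Binary.Permutation.Setoid.Properties as PermutationSetoid
open import Data.List.Relation.Binary.Subset.Propositional using (_⊆_)
open import Data.List.Relation.Unary.All using (All; []; _∷_)
import Data.List.Relation.Unary.All as All
open import Data.List.Relation.Unary.All.Properties as All using (¬Any⇒All¬; All¬⇒¬Any)
open import Data.List.Relation.Unary.AllPairs using (AllPairs; []; _∷_)
open import Data.List.Relation.Unary.Any using (Any; here; there; any?)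
open import Data.List.Relation.Unary.First as First using (first)
open import Data.List.Relation.Unary.First.Properties using (toView)
open import Data.List.Relation.Unary.Linked using (Linked; []; [-]; _∷_)
import Data.List.Relation.Unary.Linked as Linked
open import Data.List.Relation.Unary.Linked.Properties using (Linked⇒AllPairs)
open import Data.List.Relation.Unary.Unique.Propositional using (Unique)
import Data.List.Sort as Sort
open import Data.Nat using (ℕ; zero; suc; _+_; _*_; _≤_; _<_; z≤n; s≤s)
import Data.Nat as ℕ
open import Data.Nat.Properties
  using (≤-refl; ≤-trans; ≤-pred; <⇒≱; ≤∧≢⇒<; n<1+n; m≤n+m; +-suc; +-monoʳ-<; m≤n⇒∃[o]m+o≡n; ≤-decTotalOrder)
open import Data.Product using (_×_; _,_; Σ; ∃; proj₁; proj₂)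
open import Data.Sum as Sum using (_⊎_; inj₁; inj₂)
open import Function using (id; _∘_; case_of_)
open import Function.Bundles using (_⇔_; mk⇔; Equivalence)
open import Function.Definitions using (Injective)
import Relation.Binary.Construct.On as On
open import Relation.Binary.Construct.Closure.ReflexiveTransitive as Star using (Star; ε; _◅_; _◅◅_)
open import Relation.Binary.PropositionalEquality
open import Relation.Nullary using (¬_; Dec; yes; no)
open import Relation.Nullary.Decidable using (dec-true; dec-false; _⊎-dec_; toSum)
open import Relation.Unary using (Decidable)

private variable
  n : ℕ
  a b u v w w′ x y z : Fin n
  e f g : Edge n
  L G O′ : List (Edge n)
  H : List (Fin n)
  A : Set

AllPairs-middle : {R : A → A → Set} (xs : List A) {y : A} {ys : List A} → AllPairs R (xs ++ y ∷ ys) → All (R y) ys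
AllPairs-middle []       (Ry ∷ _) = Ry
AllPairs-middle (_ ∷ xs) (_ ∷ Rs) = AllPairs-middle xs Rs

Unique-++⁻ʳ : (xs : List A) {ys : List A} → Unique (xs ++ ys) → Unique ys
Unique-++⁻ʳ []       u       = u
Unique-++⁻ʳ (_ ∷ xs) (_ ∷ u) = Unique-++⁻ʳ xs u

Unique-++-apart : (xs : List A) {ys : List A} {y : A} → Unique (xs ++ ys) → y ∈ ys → y ∉ xs
Unique-++-apart (x ∷ xs) (x≢ ∷ _) y∈ys (here refl)  = All.lookup x≢ (∈-++⁺ʳ xs y∈ys) refl
Unique-++-apart (x ∷ xs) (_ ∷ u)  y∈ys (there y∈xs) = Unique-++-apart xs u y∈ys y∈xs

Linked-consecutive⁻ : {R : A → A → Set} (xs : List A) {u v : A} {ys : List A} → Linked R (xs ++ u ∷ v ∷ ys) → R u v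
Linked-consecutive⁻ []       (r ∷ _) = r
Linked-consecutive⁻ (_ ∷ xs) l       = Linked-consecutive⁻ xs (Linked.tail l)

Linked-consecutive⁺ : {R : A → A → Set} (zs : List A) →
                      (∀ xs u v ys → zs ≡ xs ++ u ∷ v ∷ ys → R u v) → Linked R zs
Linked-consecutive⁺ []           _ = []
Linked-consecutive⁺ (x ∷ [])     _ = [-]
Linked-consecutive⁺ (x ∷ y ∷ zs) R-at =
  R-at [] x y zs refl ∷ Linked-consecutive⁺ (y ∷ zs) (λ xs u v ys eq → R-at (x ∷ xs) u v ys (cong (x ∷_) eq))

Linked-++⁻ʳ : {R : A → A → Set} (xs : List A) {ys : List A} → Linked R (xs ++ ys) → Linked R ys
Linked-++⁻ʳ []       l = l
Linked-++⁻ʳ (_ ∷ xs) l = Linked-++⁻ʳ xs (Linked.tail l)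

All-last : {P : A → Set} (x : A) (xs : List A) → All P (x ∷ xs) → ∃ λ ini → ∃ λ y → x ∷ xs ≡ ini ∷ʳ y × P y
All-last x []        (px ∷ [])  = [] , x , refl , px
All-last x (x′ ∷ xs) (_ ∷ pxs) = let ini , y , eq , py = All-last x′ xs pxs in x ∷ ini , y , cong (x ∷_) eq , py

split-at-first : {P : A → Set} → Decidable P → (xs : List A) → Any P xs →
                 ∃ λ ys → ∃ λ y → ∃ λ zs → xs ≡ ys ++ y ∷ zs × All (¬_ ∘ P) ys × P y
split-at-first P? xs some with first (Sum.swap ∘ toSum ∘ P?) xs
... | inj₂ none  = ⊥-elim (All¬⇒¬Any none some)
... | inj₁ found with toView found
...   | First._++_∷_ {xs = ys} none py zs = ys , _ , zs , refl , none , py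

sorted-outside : (k : A → ℕ) (xs : List A) {a b c : A} {ys : List A} →
                 AllPairs (λ x y → k x ≤ k y) (xs ++ a ∷ b ∷ ys) → c ∈ xs ++ a ∷ b ∷ ys → k c ≤ k a ⊎ k b ≤ k c
sorted-outside k []       _               (here refl)         = inj₁ ≤-refl
sorted-outside k []       (_ ∷ _ ∷ _)     (there (here refl)) = inj₂ ≤-refl
sorted-outside k []       (_ ∷ b≤ ∷ _)    (there (there c∈))  = inj₂ (All.lookup b≤ c∈)
sorted-outside k (x ∷ xs) (x≤ ∷ _)        (here refl)         = inj₁ (All.lookup x≤ (∈-insert xs))
sorted-outside k (x ∷ xs) (_ ∷ sorted)    (there c∈)          = sorted-outside k xs sorted c∈

Incident : Edge n → Fin n → Set
Incident (a , b) v = a ≡ v ⊎ b ≡ v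

incident? : (e : Edge n) (v : Fin n) → Dec (Incident e v)
incident? (a , b) v = (a ≟ v) ⊎-dec (b ≟ v)

incident-at? : (v : Fin n) → Decidable (λ e → Incident e v)
incident-at? v e = incident? e v

Meet : Edge n → Edge n → Set
Meet {n} e f = Σ (Fin n) λ v → Incident e v × Incident f v

meet-refl : (e : Edge n) → Meet e e
meet-refl (a , b) = a , inj₁ refl , inj₁ refl

meet? : (e f : Edge n) → Dec (Meet e f)
meet? (a , b) f with incident? f a | incident? f b
... | yes p | _     = yes (a , inj₁ refl , p)
... | no _  | yes q = yes (b , inj₂ refl , q)
... | no p  | no q  = no λ { (_ , inj₁ refl , r) → p r ; (_ , inj₂ refl , r) → q r }

SameEdge-sym : SameEdge e f → SameEdge f e
SameEdge-sym (inj₁ (refl , refl)) = inj₁ (refl , refl)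
SameEdge-sym (inj₂ (refl , refl)) = inj₂ (refl , refl)

SameEdge-trans : SameEdge e f → SameEdge f g → SameEdge e g
SameEdge-trans (inj₁ (refl , refl)) q                    = q
SameEdge-trans (inj₂ (refl , refl)) (inj₁ (refl , refl)) = inj₂ (refl , refl)
SameEdge-trans (inj₂ (refl , refl)) (inj₂ (refl , refl)) = inj₁ (refl , refl)

SameEdge-flip : SameEdge e (u , v) → SameEdge e (v , u)
SameEdge-flip s = SameEdge-trans s (inj₂ (refl , refl))

incident⇒SameEdge : Incident e v → ∃ λ w → SameEdge e (v , w)
incident⇒SameEdge {e = a , b} (inj₁ refl) = b , inj₁ (refl , refl)
incident⇒SameEdge {e = a , b} (inj₂ refl) = a , inj₂ (refl , refl)

SameEdge⇒incidentˡ : SameEdge e (u , v) → Incident e u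
SameEdge⇒incidentˡ (inj₁ (refl , refl)) = inj₁ refl
SameEdge⇒incidentˡ (inj₂ (refl , refl)) = inj₂ refl

SameEdge⇒incidentʳ : SameEdge e (u , v) → Incident e v
SameEdge⇒incidentʳ = SameEdge⇒incidentˡ ∘ SameEdge-flip

SameEdge-incident⁻ : SameEdge e (u , v) → Incident e x → x ≡ u ⊎ x ≡ v
SameEdge-incident⁻ (inj₁ (refl , refl)) (inj₁ refl) = inj₁ refl
SameEdge-incident⁻ (inj₁ (refl , refl)) (inj₂ refl) = inj₂ refl
SameEdge-incident⁻ (inj₂ (refl , refl)) (inj₁ refl) = inj₂ refl
SameEdge-incident⁻ (inj₂ (refl , refl)) (inj₂ refl) = inj₁ refl

incident²⇒SameEdge : Incident e u → Incident e v → u ≢ v → SameEdge e (u , v)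
incident²⇒SameEdge (inj₁ refl) (inj₁ refl) u≢v = ⊥-elim (u≢v refl)
incident²⇒SameEdge (inj₁ refl) (inj₂ refl) u≢v = inj₁ (refl , refl)
incident²⇒SameEdge (inj₂ refl) (inj₁ refl) u≢v = inj₂ (refl , refl)
incident²⇒SameEdge (inj₂ refl) (inj₂ refl) u≢v = ⊥-elim (u≢v refl)

meet-unique : ¬ SameEdge e f → Incident e u → Incident f u → Incident e v → Incident f v → u ≡ v
meet-unique {u = u} {v = v} e≉f eu fu ev fv with u ≟ v
... | yes u≡v = u≡v
... | no u≢v  = ⊥-elim (e≉f (SameEdge-trans (incident²⇒SameEdge eu ev u≢v)
                                            (SameEdge-sym (incident²⇒SameEdge fu fv u≢v))))

SameEdge⇒≢ : proj₁ e ≢ proj₂ e → SameEdge e (u , v) → u ≢ v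
SameEdge⇒≢ e-loopless (inj₁ (refl , refl)) = e-loopless
SameEdge⇒≢ e-loopless (inj₂ (refl , refl)) = e-loopless ∘ sym

SameEdge⇒Adj : e ∈ L → SameEdge e (u , v) → Adj L u v
SameEdge⇒Adj e∈L (inj₁ (refl , refl)) = inj₁ e∈L
SameEdge⇒Adj e∈L (inj₂ (refl , refl)) = inj₂ e∈L

Adj⇒SameEdge : Adj L u v → ∃ λ e → e ∈ L × SameEdge e (u , v)
Adj⇒SameEdge (inj₁ e∈L) = _ , e∈L , inj₁ (refl , refl)
Adj⇒SameEdge (inj₂ e∈L) = _ , e∈L , inj₂ (refl , refl)

Adj-sym : Adj L u v → Adj L v u
Adj-sym (inj₁ p) = inj₂ p
Adj-sym (inj₂ p) = inj₁ p

-- Transpositions and their products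

transpose-ˡ : (a b : Fin n) → transpose a b a ≡ b
transpose-ˡ a b rewrite dec-true (a ≟ a) refl = refl

transpose-ʳ : (a b : Fin n) → transpose a b b ≡ a
transpose-ʳ a b with b ≟ a
... | yes b≡a = b≡a
... | no _ rewrite dec-true (b ≟ b) refl = refl

transpose-fix : (a b x : Fin n) → x ≢ a → x ≢ b → transpose a b x ≡ x
transpose-fix a b x x≢a x≢b rewrite dec-false (x ≟ a) x≢a | dec-false (x ≟ b) x≢b = refl

data TransposeView (a b x : Fin n) : Set where
  at-ˡ  : x ≡ a → TransposeView a b x
  at-ʳ  : x ≢ a → x ≡ b → TransposeView a b x
  apart : x ≢ a → x ≢ b → TransposeView a b x

transposeView : (a b x : Fin n) → TransposeView a b x
transposeView a b x with x ≟ a | x ≟ b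
... | yes x≡a | _       = at-ˡ x≡a
... | no x≢a  | yes x≡b = at-ʳ x≢a x≡b
... | no x≢a  | no x≢b  = apart x≢a x≢b

τ : Edge n → Fin n → Fin n
τ (a , b) = transpose a b

τ-involutive : (e : Edge n) (x : Fin n) → τ e (τ e x) ≡ x
τ-involutive (a , b) x with transposeView a b x
... | at-ˡ refl       rewrite transpose-ˡ a b = transpose-ʳ a b
... | at-ʳ _ refl     rewrite transpose-ʳ a b = transpose-ˡ a b
... | apart x≢a x≢b  rewrite transpose-fix a b x x≢a x≢b = transpose-fix a b x x≢a x≢b

τ-injective : (e : Edge n) → τ e x ≡ τ e y → x ≡ y
τ-injective {x = x} {y} e eq = trans (sym (τ-involutive e x)) (trans (cong (τ e) eq) (τ-involutive e y))

τ-fix : (e : Edge n) → ¬ Incident e x → τ e x ≡ x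
τ-fix {x = x} (a , b) ¬ex = transpose-fix a b x (¬ex ∘ inj₁ ∘ sym) (¬ex ∘ inj₂ ∘ sym)

τ-endˡ : SameEdge e (u , v) → τ e u ≡ v
τ-endˡ {e = a , b} (inj₁ (refl , refl)) = transpose-ˡ a b
τ-endˡ {e = a , b} (inj₂ (refl , refl)) = transpose-ʳ a b

τ-endʳ : SameEdge e (u , v) → τ e v ≡ u
τ-endʳ = τ-endˡ ∘ SameEdge-flip

τ-comm : (e f : Edge n) → ¬ Meet e f → (x : Fin n) → τ e (τ f x) ≡ τ f (τ e x)
τ-comm (a , b) (c , d) e∤f x = go (transposeView c d x) (transposeView a b x)
  where
  a≢c : a ≢ c
  a≢c p = e∤f (a , inj₁ refl , inj₁ (sym p))
  a≢d : a ≢ d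
  a≢d p = e∤f (a , inj₁ refl , inj₂ (sym p))
  b≢c : b ≢ c
  b≢c p = e∤f (b , inj₂ refl , inj₁ (sym p))
  b≢d : b ≢ d
  b≢d p = e∤f (b , inj₂ refl , inj₂ (sym p))
  go : TransposeView c d x → TransposeView a b x →
       transpose a b (transpose c d x) ≡ transpose c d (transpose a b x)
  go (at-ˡ refl) (at-ˡ q) = ⊥-elim (a≢c (sym q))
  go (at-ˡ refl) (at-ʳ _ q) = ⊥-elim (b≢c (sym q))
  go (at-ˡ refl) (apart p q) rewrite transpose-ˡ c d | transpose-fix a b c p q | transpose-ˡ c d =
    transpose-fix a b d (a≢d ∘ sym) (b≢d ∘ sym)
  go (at-ʳ _ refl) (at-ˡ q) = ⊥-elim (a≢d (sym q))
  go (at-ʳ _ refl) (at-ʳ _ q) = ⊥-elim (b≢d (sym q))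
  go (at-ʳ _ refl) (apart p q) rewrite transpose-ʳ c d | transpose-fix a b d p q | transpose-ʳ c d =
    transpose-fix a b c (a≢c ∘ sym) (b≢c ∘ sym)
  go (apart p q) (at-ˡ refl) rewrite transpose-fix c d a p q | transpose-ˡ a b = sym (transpose-fix c d b b≢c b≢d)
  go (apart p q) (at-ʳ _ refl) rewrite transpose-fix c d b p q | transpose-ʳ a b = sym (transpose-fix c d a a≢c a≢d)
  go (apart p q) (apart p′ q′) rewrite transpose-fix c d x p q | transpose-fix a b x p′ q′ = sym (transpose-fix c d x p q)

product-++ : (xs ys : List (Edge n)) (x : Fin n) → product (xs ++ ys) x ≡ product xs (product ys x)
product-++ [] ys x = refl
product-++ ((a , b) ∷ xs) ys x = cong (transpose a b) (product-++ xs ys x)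

product-reverseʳ : (xs : List (Edge n)) (x : Fin n) → product xs (product (reverse xs) x) ≡ x
product-reverseʳ [] x = refl
product-reverseʳ (e@(a , b) ∷ xs) x = begin
  τ e (product xs (product (reverse (e ∷ xs)) x))    ≡⟨ cong (λ ys → τ e (product xs (product ys x))) (unfold-reverse e xs) ⟩
  τ e (product xs (product (reverse xs ++ e ∷ []) x)) ≡⟨ cong (τ e ∘ product xs) (product-++ (reverse xs) (e ∷ []) x) ⟩
  τ e (product xs (product (reverse xs) (τ e x)))    ≡⟨ cong (τ e) (product-reverseʳ xs (τ e x)) ⟩
  τ e (τ e x)                                        ≡⟨ τ-involutive e x ⟩
  x                                                  ∎
  where open ≡-Reasoning

product-reverseˡ : (xs : List (Edge n)) (x : Fin n) → product (reverse xs) (product xs x) ≡ x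
product-reverseˡ xs x =
  subst (λ ys → product (reverse xs) (product ys x) ≡ x) (reverse-involutive xs) (product-reverseʳ (reverse xs) x)

product-injective : (xs : List (Edge n)) → product xs x ≡ product xs y → x ≡ y
product-injective {x = x} {y} xs eq =
  trans (sym (product-reverseˡ xs x)) (trans (cong (product (reverse xs)) eq) (product-reverseˡ xs y))

product-fix : (xs : List (Edge n)) → All (λ e → ¬ Incident e v) xs → product xs v ≡ v
product-fix [] [] = refl
product-fix {v = v} (e ∷ xs) (¬ev ∷ rest) = trans (cong (τ e) (product-fix xs rest)) (τ-fix e ¬ev)

product-τ-comm : (e : Edge n) (L : List (Edge n)) → All (λ f → ¬ Meet e f) L →
                 (x : Fin n) → product L (τ e x) ≡ τ e (product L x)
product-τ-comm e [] [] x = refl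
product-τ-comm e (f ∷ L) (e∤f ∷ rest) x = begin
  τ f (product L (τ e x))  ≡⟨ cong (τ f) (product-τ-comm e L rest x) ⟩
  τ f (τ e (product L x))  ≡⟨ sym (τ-comm e f e∤f (product L x)) ⟩
  τ e (τ f (product L x))  ∎
  where open ≡-Reasoning

-- Walks and cycles

Walk : List (Edge n) → Fin n → Fin n → Set
Walk L = Star (Adj L)

visited : {L : List (Edge n)} → Walk L x y → List (Fin n)
visited ε               = []
visited (_◅_ {j = y} _ w) = y ∷ visited w

vertices : {L : List (Edge n)} → Walk L x y → List (Fin n)
vertices {x = x} w = x ∷ visited w

Avoids : {L : List (Edge n)} → Fin n → Walk L x y → Set
Avoids v w = All (_≢ v) (vertices w)

Adj-mono : L ⊆ G → Adj L u v → Adj G u v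
Adj-mono L⊆G (inj₁ p) = inj₁ (L⊆G p)
Adj-mono L⊆G (inj₂ p) = inj₂ (L⊆G p)

HasCycle-mono : L ⊆ G → HasCycle L → HasCycle G
HasCycle-mono L⊆G (x , ys , long , distinct , closed) = x , ys , long , distinct , Linked.map (Adj-mono L⊆G) closed

walk-mono : L ⊆ G → Walk L x y → Walk G x y
walk-mono L⊆G = Star.map (Adj-mono L⊆G)

visited-mono : (L⊆G : L ⊆ G) (w : Walk L x y) → visited (walk-mono L⊆G w) ≡ visited w
visited-mono L⊆G ε       = refl
visited-mono L⊆G (a ◅ w) = cong (_ ∷_) (visited-mono L⊆G w)

avoids-mono : (L⊆G : L ⊆ G) (w : Walk L x y) → Avoids v w → Avoids v (walk-mono L⊆G w)
avoids-mono {x = x} {v = v} L⊆G w = subst (λ vs → All (_≢ v) (x ∷ vs)) (sym (visited-mono L⊆G w))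

avoids-◅◅ : (w₁ : Walk L x y) (w₂ : Walk L y z) → Avoids v w₁ → Avoids v w₂ → Avoids v (w₁ ◅◅ w₂)
avoids-◅◅ ε        w₂ _          av₂ = av₂
avoids-◅◅ (a ◅ w₁) w₂ (x≢v ∷ av₁) av₂ = x≢v ∷ avoids-◅◅ w₁ w₂ av₁ av₂

avoids-reverse : (w : Walk L x y) → Avoids v w → Avoids v (Star.reverse Adj-sym w)
avoids-reverse w av = revApp⁺ w ε av (All.head av ∷ [])
  where
  revApp⁺ : (w : Walk L x y) (acc : Walk L x z) → Avoids v w → Avoids v acc →
            Avoids v (Star.revApp Adj-sym w acc)
  revApp⁺ ε       acc _         avᵃ = avᵃ
  revApp⁺ (a ◅ w) acc (_ ∷ avʷ) avᵃ = revApp⁺ w (Adj-sym a ◅ acc) avʷ (All.head avʷ ∷ avᵃ)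

avoids⇒∉ : (w : Walk L x y) → Avoids v w → v ∉ vertices w
avoids⇒∉ w av v∈w = All.lookup av v∈w refl

suffix-from : (w : Walk L a b) → x ∈ vertices w →
              Σ (Walk L x b) λ w′ → vertices w′ ⊆ vertices w × (Unique (vertices w) → Unique (vertices w′))
suffix-from w       (here refl) = w , id , id
suffix-from (_ ◅ w) (there x∈w) with suffix-from w x∈w
... | w′ , w′⊆w , unique = w′ , there ∘ w′⊆w , λ { (_ ∷ u) → unique u }

shortcut : (w : Walk L a b) → Σ (Walk L a b) λ p → Unique (vertices p) × vertices p ⊆ vertices w
shortcut ε = ε , [] ∷ [] , id
shortcut {a = a} (s ◅ w) with shortcut w
... | p , unique , p⊆w with any? (a ≟_) (vertices p)
...   | yes a∈p = let p′ , p′⊆p , unique′ = suffix-from p a∈p in p′ , unique′ unique , there ∘ p⊆w ∘ p′⊆p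
...   | no a∉p  = s ◅ p , ¬Any⇒All¬ _ a∉p ∷ unique , λ { (here r) → here r ; (there r) → there (p⊆w r) }

path-closes-cycle : (p : Walk L a b) → Unique (vertices p) → Adj L b a → 2 ≤ length (visited p) → HasCycle L
path-closes-cycle {a = a} p unique b~a long = a , visited p , long , unique , closed p b~a
  where
  closed : (p : Walk L x y) → Adj L y z → Linked (Adj L) (vertices p ∷ʳ z)
  closed ε       y~z = y~z ∷ [-]
  closed (s ◅ p) y~z = s ∷ closed p y~z

cycle-through : (w : Walk L a b) → a ≢ b → Avoids v w → Adj L v a → Adj L v b → HasCycle L
cycle-through {v = v} w a≢b av v~a v~b with shortcut w
... | p , unique , p⊆w = path-closes-cycle (v~a ◅ p) (v∉p ∷ unique) (Adj-sym v~b) (s≤s (nonempty p a≢b))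
  where
  v∉p : All (v ≢_) (vertices p)
  v∉p = ¬Any⇒All¬ _ (avoids⇒∉ w av ∘ p⊆w)
  nonempty : (p : Walk L x y) → x ≢ y → 1 ≤ length (visited p)
  nonempty ε       x≢y = ⊥-elim (x≢y refl)
  nonempty (_ ◅ _) _   = s≤s z≤n

cycle-closing : L ⊆ G → Walk L a b → a ≢ b → ¬ Adj L a b → Adj G b a → HasCycle G
cycle-closing L⊆G w a≢b ¬a~b b~a with shortcut w
... | p , unique , _ =
  path-closes-cycle (walk-mono L⊆G p) (subst (λ vs → Unique (_ ∷ vs)) (sym (visited-mono L⊆G p)) unique) b~a
    (subst (λ vs → 2 ≤ length vs) (sym (visited-mono L⊆G p)) (long p a≢b ¬a~b))
  where
  long : (p : Walk L x y) → x ≢ y → ¬ Adj L x y → 2 ≤ length (visited p)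
  long ε               x≢y _     = ⊥-elim (x≢y refl)
  long (s ◅ ε)         _   ¬x~y = ⊥-elim (¬x~y s)
  long (_ ◅ (_ ◅ _))   _   _     = s≤s (s≤s z≤n)

first-visit : (w : Walk L a b) → a ≢ v →
              Avoids v w ⊎ ∃ λ u → Σ (Walk L a u) (Avoids v) × Adj L u v
first-visit ε a≢v = inj₁ (a≢v ∷ [])
first-visit {v = v} (_◅_ {j = y} s w) a≢v with y ≟ v
... | yes refl = inj₂ (_ , (ε , a≢v ∷ []) , s)
... | no y≢v with first-visit w y≢v
...   | inj₁ av                  = inj₁ (a≢v ∷ av)
...   | inj₂ (u , (w′ , av) , u~v) = inj₂ (u , (s ◅ w′ , a≢v ∷ av) , u~v)

-- A walk reaching v would, up to its first visit, close a cycle with the edge wv.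
walk-avoids-neighbour : L ⊆ G → ¬ HasCycle G → Adj G v w → w ≢ v → ¬ Adj L w v →
                        Walk L w x → Σ (Walk G w x) (Avoids v)
walk-avoids-neighbour {w = w} L⊆G acyclic v~w w≢v ¬w~v W with first-visit W w≢v
... | inj₁ av = walk-mono L⊆G W , avoids-mono L⊆G W av
... | inj₂ (u , (W′ , av) , u~v) with w ≟ u
...   | yes refl = ⊥-elim (¬w~v u~v)
...   | no w≢u   = ⊥-elim (acyclic (cycle-through (walk-mono L⊆G W′) w≢u (avoids-mono L⊆G W′ av)
                                                 v~w (Adj-sym (Adj-mono L⊆G u~v))))

avoids-end : (w : Walk L x y) → Avoids v w → y ≢ v
avoids-end ε       (x≢v ∷ []) = x≢v
avoids-end (_ ◅ w) (_ ∷ av)   = avoids-end w av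

closing-walk : ¬ HasCycle L → e ∈ L → f ∈ L → ¬ SameEdge e f → SameEdge e (v , w) → SameEdge f (v , w′) →
               (W : Walk L w w′) → Avoids v W → ⊥
closing-walk {w = w} {w′ = w′} acyclic e∈L f∈L e≉f e≈vw f≈vw′ W avoids with w ≟ w′
... | yes refl = e≉f (SameEdge-trans e≈vw (SameEdge-sym f≈vw′))
... | no w≢w′  = acyclic (cycle-through W w≢w′ avoids (SameEdge⇒Adj e∈L e≈vw) (SameEdge⇒Adj f∈L f≈vw′))

-- The product of an ordering of a tree is a cycle

IsSimple-resp-↭ : {O E : List (Edge n)} → O ↭ E → IsSimple E → IsSimple O
IsSimple-resp-↭ O↭E (loopless , distinct) =
  All-resp-↭ (↭-sym O↭E) loopless ,
  PermutationSetoid.AllPairs-resp-↭ (setoid _) (λ ¬s s → ¬s (SameEdge-sym s)) (resp₂ _) (↭⇒↭ₛ (↭-sym O↭E)) distinct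

↭⇒⊆ : {O E : List (Edge n)} → O ↭ E → O ⊆ E
↭⇒⊆ O↭E = ∈-resp-↭ O↭E

ordering-simple : {O E : List (Edge n)} → IsTree E → O ↭ E → IsSimple O
ordering-simple (simple , _ , _) O↭E = IsSimple-resp-↭ O↭E simple

ordering-acyclic : {O E : List (Edge n)} → IsTree E → O ↭ E → ¬ HasCycle O
ordering-acyclic (_ , _ , acyclic) O↭E = acyclic ∘ HasCycle-mono (↭⇒⊆ O↭E)

distinct⇒¬Adj : All (λ f → ¬ SameEdge e f) L → SameEdge e (u , v) → ¬ Adj L v u
distinct⇒¬Adj distinct e≈uv (inj₁ vu∈L) = All.lookup distinct vu∈L (SameEdge-flip e≈uv)
distinct⇒¬Adj distinct e≈uv (inj₂ uv∈L) = All.lookup distinct uv∈L e≈uv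

walk-of-product : (L : List (Edge n)) (x : Fin n) → Walk L x (product L x)
walk-of-product []            x = ε
walk-of-product ((a , b) ∷ L) x = extend (transposeView a b (product L x)) (walk-mono there (walk-of-product L x))
  where
  extend : TransposeView a b y → Walk ((a , b) ∷ L) x y → Walk ((a , b) ∷ L) x (transpose a b y)
  extend (at-ˡ refl)   w = subst (Walk _ x) (sym (transpose-ˡ a b)) (w ◅◅ inj₁ (here refl) ◅ ε)
  extend (at-ʳ _ refl) w = subst (Walk _ x) (sym (transpose-ʳ a b)) (w ◅◅ inj₂ (here refl) ◅ ε)
  extend (apart p q)   w = subst (Walk _ x) (sym (transpose-fix a b _ p q)) w

Reaches : (Fin n → Fin n) → Fin n → Fin n → Set
Reaches c x y = ∃ λ k → iter c k x ≡ y

iter-+ : (c : Fin n → Fin n) (k l : ℕ) (x : Fin n) → iter c (k + l) x ≡ iter c k (iter c l x)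
iter-+ c zero    l x = refl
iter-+ c (suc k) l x = cong c (iter-+ c k l x)

iter-injective : (c : Fin n → Fin n) → Injective _≡_ _≡_ c → (k : ℕ) → iter c k x ≡ iter c k y → x ≡ y
iter-injective c c-inj zero    eq = eq
iter-injective c c-inj (suc k) eq = iter-injective c c-inj k (c-inj eq)

reaches-refl : {c : Fin n → Fin n} → Reaches c x x
reaches-refl = 0 , refl

reaches-step : {c : Fin n → Fin n} → Reaches c x (c x)
reaches-step = 1 , refl

reaches-trans : {c : Fin n → Fin n} → Reaches c x y → Reaches c y z → Reaches c x z
reaches-trans {x = x} {c = c} (k , cᵏx≡y) (l , cˡy≡z) = l + k , trans (iter-+ c l k x) (trans (cong (iter c l) cᵏx≡y) cˡy≡z)

-- Pigeonhole on x, c x, …, cⁿ x, then cancel the common prefix by injectivity.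
iter-returns : (c : Fin n → Fin n) → Injective _≡_ _≡_ c → (x : Fin n) → ∃ λ p → iter c (suc p) x ≡ x
iter-returns {n} c c-inj x with pigeonhole (n<1+n n) (λ i → iter c (toℕ i) x)
... | i , j , i<j , cⁱx≡cʲx with m≤n⇒∃[o]m+o≡n i<j
...   | p , i+1+p≡j = p , iter-injective c c-inj (toℕ i) (begin
  iter c (toℕ i) (iter c (suc p) x) ≡⟨ iter-+ c (toℕ i) (suc p) x ⟨
  iter c (toℕ i + suc p) x          ≡⟨ cong (λ k → iter c k x) (trans (+-suc (toℕ i) p) i+1+p≡j) ⟩
  iter c (toℕ j) x                  ≡⟨ cⁱx≡cʲx ⟨
  iter c (toℕ i) x                  ∎)
  where open ≡-Reasoning

reaches⇒walk : (L : List (Edge n)) → Reaches (product L) x y → Walk L x y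
reaches⇒walk L (zero , refl)           = ε
reaches⇒walk {x = x} L (suc k , refl) = reaches⇒walk L (k , refl) ◅◅ walk-of-product L (iter (product L) k x)

-- Along the orbit of x, T ∘ c agrees with c until the orbit closes up; there T jumps to y.
reaches-after-joining : (c T : Fin n → Fin n) → Injective _≡_ _≡_ c → T x ≡ y →
                        (∀ u → u ≢ x → u ≢ y → T u ≡ u) → ¬ Reaches c x y → Reaches (T ∘ c) x y
reaches-after-joining {x = x} {y = y} c T c-inj Tx≡y T-fix ¬x→y = close (iter-returns c c-inj x)
  where
  agree-or-reach : ∀ i → iter (T ∘ c) i x ≡ iter c i x ⊎ Reaches (T ∘ c) x y
  agree-or-reach zero = inj₁ refl
  agree-or-reach (suc i) with agree-or-reach i
  ... | inj₂ x→y = inj₂ x→y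
  ... | inj₁ agree with c (iter c i x) ≟ x | c (iter c i x) ≟ y
  ...   | yes back | _       = inj₂ (suc i , trans (cong (T ∘ c) agree) (trans (cong T back) Tx≡y))
  ...   | no _     | yes hit = ⊥-elim (¬x→y (suc i , hit))
  ...   | no ≢x    | no ≢y   = inj₁ (trans (cong (T ∘ c) agree) (T-fix _ ≢x ≢y))
  close : (∃ λ p → iter c (suc p) x ≡ x) → Reaches (T ∘ c) x y
  close (p , cᵖ⁺¹x≡x) with agree-or-reach p
  ... | inj₂ x→y   = x→y
  ... | inj₁ agree = suc p , trans (cong (T ∘ c) agree) (trans (cong T cᵖ⁺¹x≡x) Tx≡y)

reaches-lift : (c : Fin n → Fin n) (a b : Fin n) →
               Reaches (transpose a b ∘ c) a b → Reaches (transpose a b ∘ c) b a →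
               Reaches c x y → Reaches (transpose a b ∘ c) x y
reaches-lift c a b a→b b→a (zero , refl)       = reaches-refl
reaches-lift {x = x} c a b a→b b→a (suc k , refl) =
  reaches-trans (reaches-lift c a b a→b b→a (k , refl)) (one-step (iter c k x))
  where
  one-step : ∀ z → Reaches (transpose a b ∘ c) z (c z)
  one-step z with transposeView a b (c z)
  ... | at-ˡ cz≡a   = reaches-trans (subst (Reaches _ z) (trans (cong (transpose a b) cz≡a) (transpose-ˡ a b)) reaches-step)
                                    (subst (Reaches _ b) (sym cz≡a) b→a)
  ... | at-ʳ _ cz≡b = reaches-trans (subst (Reaches _ z) (trans (cong (transpose a b) cz≡b) (transpose-ʳ a b)) reaches-step)
                                    (subst (Reaches _ a) (sym cz≡b) a→b)
  ... | apart p q   = subst (Reaches _ z) (transpose-fix a b (c z) p q) reaches-step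

-- The rest of the ordering cannot join the ends of its first edge (that would close a cycle),
-- so the first transposition merges their orbits.
first-edge-ends-reach : (a b : Fin n) (rest : List (Edge n)) → IsSimple ((a , b) ∷ rest) → ¬ HasCycle ((a , b) ∷ rest) →
                        Reaches (product ((a , b) ∷ rest)) a b × Reaches (product ((a , b) ∷ rest)) b a
first-edge-ends-reach {n} a b rest (a≢b ∷ _ , distinct ∷ _) acyclic =
  reaches-after-joining c (transpose a b) (product-injective rest) (transpose-ˡ a b) (λ u p q → transpose-fix a b u p q) ¬a→b ,
  reaches-after-joining c (transpose a b) (product-injective rest) (transpose-ʳ a b) (λ u p q → transpose-fix a b u q p) ¬b→a
  where
  c : Fin n → Fin n
  c = product rest
  ¬a→b : ¬ Reaches c a b
  ¬a→b r = acyclic (cycle-closing there (reaches⇒walk rest r) a≢b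
                      (distinct⇒¬Adj distinct (inj₂ (refl , refl))) (inj₂ (here refl)))
  ¬b→a : ¬ Reaches c b a
  ¬b→a r = acyclic (cycle-closing there (reaches⇒walk rest r) (a≢b ∘ sym)
                      (distinct⇒¬Adj distinct (inj₁ (refl , refl))) (inj₁ (here refl)))

edge-ends-reach : (O : List (Edge n)) → IsSimple O → ¬ HasCycle O → (u , v) ∈ O →
                  Reaches (product O) u v × Reaches (product O) v u
edge-ends-reach ((a , b) ∷ rest) simple acyclic (here refl) = first-edge-ends-reach a b rest simple acyclic
edge-ends-reach ((a , b) ∷ rest) simple@(_ ∷ loopless , _ ∷ distincts) acyclic (there uv∈rest) =
  let a→b , b→a = first-edge-ends-reach a b rest simple acyclic
      u→v , v→u = edge-ends-reach rest (loopless , distincts) (acyclic ∘ HasCycle-mono there) uv∈rest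
  in reaches-lift (product rest) a b a→b b→a u→v , reaches-lift (product rest) a b a→b b→a v→u

tree-ordering-isCycle : {E O : List (Edge (suc n))} → IsTree E → O ↭ E → IsCycle (product O)
tree-ordering-isCycle {O = O} tree@(_ , connected , _) O↭E = zero , λ y _ → along (connected zero y)
  where
  reaches-neighbour : Adj O u v → Reaches (product O) u v
  reaches-neighbour (inj₁ uv∈O) = proj₁ (edge-ends-reach O (ordering-simple tree O↭E) (ordering-acyclic tree O↭E) uv∈O)
  reaches-neighbour (inj₂ vu∈O) = proj₂ (edge-ends-reach O (ordering-simple tree O↭E) (ordering-acyclic tree O↭E) vu∈O)
  along : Star (Adj _) x y → Reaches (product O) x y
  along ε         = reaches-refl
  along (s ◅ st) = reaches-trans (reaches-neighbour (Adj-mono (↭⇒⊆ (↭-sym O↭E)) s)) (along st)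

-- A chain ordering is the only ordering with its product

Chain : List (Edge n) → Set
Chain = Linked Meet

product-slide : (L₁ : List (Edge n)) {R₁ : List (Edge n)} → All (¬_ ∘ Meet e) L₁ →
                (x : Fin n) → product (L₁ ++ e ∷ R₁) x ≡ τ e (product (L₁ ++ R₁) x)
product-slide {e = e} L₁ {R₁} e∤L₁ x = begin
  product (L₁ ++ e ∷ R₁) x          ≡⟨ product-++ L₁ (e ∷ R₁) x ⟩
  product L₁ (τ e (product R₁ x))   ≡⟨ product-τ-comm e L₁ e∤L₁ (product R₁ x) ⟩
  τ e (product L₁ (product R₁ x))   ≡⟨ cong (τ e) (product-++ L₁ R₁ x) ⟨
  τ e (product (L₁ ++ R₁) x)        ∎
  where open ≡-Reasoning

-- O = e ∷ rest with e = vw, and g = vw′ is the first edge of O′ at v. Both products send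
-- rest⁻¹(w) to v, so the two preimages agree; tracing them back gives walks from w and from w′
-- to a common vertex avoiding v, and acyclicity forces w = w′.
first-edges-at-agree : {rest L₁ R₁ : List (Edge n)} → ¬ HasCycle (L₁ ++ g ∷ R₁) → e ∷ rest ⊆ L₁ ++ g ∷ R₁ →
  All (λ f → ¬ SameEdge e f) rest → All (λ f → ¬ SameEdge g f) R₁ →
  product (L₁ ++ g ∷ R₁) ≗ product (e ∷ rest) → All (λ f → ¬ Incident f v) L₁ →
  SameEdge e (v , w) → SameEdge g (v , w′) → w ≢ v → w′ ≢ v → w ≡ w′
first-edges-at-agree {n} {g = g} {e = e} {v = v} {w = w} {w′ = w′} {rest = rest} {L₁} {R₁}
                     acyclic e∷rest⊆O′ e≉rest g≉R₁ same L₁∌v e≈vw g≈vw′ w≢v w′≢v with w ≟ w′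
... | yes w≡w′ = w≡w′
... | no w≢w′  = ⊥-elim (acyclic (cycle-through (proj₁ V₁ ◅◅ Star.reverse Adj-sym (proj₁ V₂)) w≢w′
                   (avoids-◅◅ (proj₁ V₁) _ (proj₂ V₁) (avoids-reverse (proj₁ V₂) (proj₂ V₂)))
                   (SameEdge⇒Adj (e∷rest⊆O′ (here refl)) e≈vw) (SameEdge⇒Adj g∈O′ g≈vw′)))
  where
  g∈O′ : g ∈ L₁ ++ g ∷ R₁
  g∈O′ = ∈-insert L₁
  p p′ : Fin n
  p  = product (reverse rest) w
  p′ = product (reverse R₁) w′
  O-sends-p : product (e ∷ rest) p ≡ v
  O-sends-p = trans (cong (τ e) (product-reverseʳ rest w)) (τ-endʳ e≈vw)
  O′-sends-p′ : product (L₁ ++ g ∷ R₁) p′ ≡ v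
  O′-sends-p′ = begin
    product (L₁ ++ g ∷ R₁) p′                               ≡⟨ product-++ L₁ (g ∷ R₁) p′ ⟩
    product L₁ (τ g (product R₁ (product (reverse R₁) w′))) ≡⟨ cong (product L₁ ∘ τ g) (product-reverseʳ R₁ w′) ⟩
    product L₁ (τ g w′)                                     ≡⟨ cong (product L₁) (τ-endʳ g≈vw′) ⟩
    product L₁ v                                            ≡⟨ product-fix L₁ L₁∌v ⟩
    v                                                       ∎
    where open ≡-Reasoning
  p≡p′ : p ≡ p′
  p≡p′ = product-injective (L₁ ++ g ∷ R₁) (trans (same p) (trans O-sends-p (sym O′-sends-p′)))
  back-to : (L : List (Edge n)) (x : Fin n) → Walk L x (product (reverse L) x)
  back-to L x = Star.reverse Adj-sym (subst (Walk L _) (product-reverseʳ L x) (walk-of-product L (product (reverse L) x)))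
  V₁ : Σ (Walk (L₁ ++ g ∷ R₁) w p′) (Avoids v)
  V₁ = subst (λ t → Σ (Walk (L₁ ++ g ∷ R₁) w t) (Avoids v)) p≡p′
         (walk-avoids-neighbour (e∷rest⊆O′ ∘ there) acyclic (SameEdge⇒Adj (e∷rest⊆O′ (here refl)) e≈vw) w≢v
                                (distinct⇒¬Adj e≉rest e≈vw) (back-to rest w))
  V₂ : Σ (Walk (L₁ ++ g ∷ R₁) w′ p′) (Avoids v)
  V₂ = walk-avoids-neighbour (∈-++⁺ʳ L₁ ∘ there) acyclic (SameEdge⇒Adj g∈O′ g≈vw′) w′≢v
                             (distinct⇒¬Adj g≉R₁ g≈vw′) (back-to R₁ w′)

first-meeting-is-head : {rest L₁ R₁ : List (Edge n)} →
  IsSimple (L₁ ++ g ∷ R₁) → ¬ HasCycle (L₁ ++ g ∷ R₁) → IsSimple (e ∷ rest) → e ∷ rest ⊆ L₁ ++ g ∷ R₁ →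
  product (L₁ ++ g ∷ R₁) ≗ product (e ∷ rest) → All (¬_ ∘ Meet e) L₁ → Meet e g → g ≡ e
first-meeting-is-head {g = g} {e = e} {L₁ = L₁} {R₁} (loopless′ , distinct′) acyclic′ (e-loopless ∷ _ , e≉rest ∷ _)
                      e∷rest⊆O′ same e∤L₁ (v , e∋v , g∋v) with ∈-++⁻ L₁ (e∷rest⊆O′ (here refl))
... | inj₁ e∈L₁           = ⊥-elim (All.lookup e∤L₁ e∈L₁ (meet-refl e))
... | inj₂ (here e≡g)     = sym e≡g
... | inj₂ (there e∈R₁)   = ⊥-elim (All.lookup g≉R₁ e∈R₁ g≈e)
  where
  g≉R₁ : All (λ f → ¬ SameEdge g f) R₁
  g≉R₁ = AllPairs-middle L₁ distinct′
  ew : ∃ λ w → SameEdge e (v , w)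
  ew = incident⇒SameEdge e∋v
  gw : ∃ λ w′ → SameEdge g (v , w′)
  gw = incident⇒SameEdge g∋v
  w≡w′ : proj₁ ew ≡ proj₁ gw
  w≡w′ = first-edges-at-agree acyclic′ e∷rest⊆O′ e≉rest g≉R₁ same
           (All.map (λ e∤f f∋v → e∤f (v , e∋v , f∋v)) e∤L₁) (proj₂ ew) (proj₂ gw)
           (SameEdge⇒≢ e-loopless (proj₂ ew) ∘ sym) (SameEdge⇒≢ (All.lookup loopless′ (∈-insert L₁)) (proj₂ gw) ∘ sym)
  g≈e : SameEdge g e
  g≈e = SameEdge-trans (subst (λ t → SameEdge g (v , t)) (sym w≡w′) (proj₂ gw)) (SameEdge-sym (proj₂ ew))

-- The first edge of any ordering with the same product that meets the first edge e of O is e itself,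
-- and everything before it commutes past e; the chain condition then leaves nothing before it.
chain-ordering-unique : (O : List (Edge n)) → IsSimple O → ¬ HasCycle O → Chain O →
                        O′ ↭ O → product O′ ≗ product O → O′ ≡ O
chain-ordering-unique [] _ _ _ O′↭[] _ = ↭-empty-inv O′↭[]
chain-ordering-unique {O′ = O′} (e ∷ rest) simple@(_ ∷ loopless , _ ∷ distinct) acyclic chain O′↭O same
  with split-at-first (meet? e) O′ (lose (∈-resp-↭ (↭-sym O′↭O) (here refl)) (meet-refl e))
... | L₁ , g , R₁ , refl , e∤L₁ , e~g
  with first-meeting-is-head (IsSimple-resp-↭ O′↭O simple) (acyclic ∘ HasCycle-mono (↭⇒⊆ O′↭O)) simple
                             (∈-resp-↭ (↭-sym O′↭O)) same e∤L₁ e~g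
... | refl = nothing-before L₁ e∤L₁ rest-unique
  where
  same-rest : product (L₁ ++ R₁) ≗ product rest
  same-rest x = τ-injective e (trans (sym (product-slide L₁ e∤L₁ x)) (same x))
  rest-unique : L₁ ++ R₁ ≡ rest
  rest-unique = chain-ordering-unique rest (loopless , distinct) (acyclic ∘ HasCycle-mono there) (Linked.tail chain)
                                      (drop-mid L₁ [] O′↭O) same-rest
  nothing-before : ∀ L → All (¬_ ∘ Meet e) L → L ++ R₁ ≡ rest → L ++ e ∷ R₁ ≡ e ∷ rest
  nothing-before []      _          refl = refl
  nothing-before (h ∷ L) (e∤h ∷ _) refl = ⊥-elim (e∤h (Linked.head chain))

unique-ordering⇒chain : (O : List (Edge n)) → (∀ O′ → O′ ↭ O → product O′ ≗ product O → O′ ≡ O) → Chain O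
unique-ordering⇒chain []          _      = []
unique-ordering⇒chain (e ∷ [])    _      = [-]
unique-ordering⇒chain (e ∷ f ∷ r) unique =
  e~f ∷ unique-ordering⇒chain (f ∷ r) (λ O′ O′↭ same → ∷-injectiveʳ (unique (e ∷ O′) (↭-prep e O′↭) (cong (τ e) ∘ same)))
  where
  swapped : ¬ Meet e f → f ∷ e ∷ r ≡ e ∷ f ∷ r
  swapped e∤f = unique (f ∷ e ∷ r) (↭-swap f e ↭-refl) (λ x → sym (τ-comm e f e∤f (product r x)))
  e~f : Meet e f
  e~f with meet? e f
  ... | yes e~f = e~f
  ... | no e∤f  = ⊥-elim (e∤f (subst (Meet e) (sym (∷-injectiveˡ (swapped e∤f))) (meet-refl e)))

incident-edges : List (Edge n) → Fin n → List (Edge n)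
incident-edges L v = filter (incident-at? v) L

degree≡length-incident-edges : (L : List (Edge n)) (v : Fin n) → degree L v ≡ length (incident-edges L v)
degree≡length-incident-edges []            v = refl
degree≡length-incident-edges ((a , b) ∷ L) v with a ≟ v | b ≟ v
... | yes _ | _     = cong suc (degree≡length-incident-edges L v)
... | no _  | yes _ = cong suc (degree≡length-incident-edges L v)
... | no _  | no _  = degree≡length-incident-edges L v

degree-resp-↭ : L ↭ G → (v : Fin n) → degree L v ≡ degree G v
degree-resp-↭ {L = L} {G = G} L↭G v = begin
  degree L v                       ≡⟨ degree≡length-incident-edges L v ⟩
  length (incident-edges L v)      ≡⟨ ↭-length (filter-↭ (incident-at? v) L↭G) ⟩
  length (incident-edges G v)      ≡⟨ degree≡length-incident-edges G v ⟨
  degree G v                       ∎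
  where open ≡-Reasoning

degree-pos : e ∈ L → Incident e v → 1 ≤ degree L v
degree-pos {L = L} {v = v} e∈L ev =
  subst (1 ≤_) (sym (degree≡length-incident-edges L v)) (∈-length (∈-filter⁺ (incident-at? v) e∈L ev))

degree-pos⁻ : 1 ≤ degree L v → ∃ λ e → e ∈ L × Incident e v
degree-pos⁻ {L = L} {v = v} d with incident-edges L v in eq | subst (1 ≤_) (degree≡length-incident-edges L v) d
... | e ∷ _ | _ = e , ∈-filter⁻ (incident-at? v) (subst (e ∈_) (sym eq) (here refl))

leaf-edge-unique : IsLeaf L v → e ∈ L → f ∈ L → Incident e v → Incident f v → e ≡ f
leaf-edge-unique {L = L} {v = v} leaf e∈L f∈L ev fv =
  singleton (incident-edges L v) (trans (sym (degree≡length-incident-edges L v)) leaf)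
            (∈-filter⁺ (incident-at? v) e∈L ev) (∈-filter⁺ (incident-at? v) f∈L fv)
  where
  singleton : (xs : List (Edge n)) → length xs ≡ 1 → e ∈ xs → f ∈ xs → e ≡ f
  singleton (_ ∷ []) _ (here refl) (here refl) = refl

degree-split : (xs : List (Edge n)) {ys : List (Edge n)} → Incident e v →
               degree (xs ++ e ∷ ys) v ≡ length (incident-edges xs v) + suc (degree ys v)
degree-split {e = e} {v = v} xs {ys} ev = begin
  degree (xs ++ e ∷ ys) v                                          ≡⟨ degree≡length-incident-edges (xs ++ e ∷ ys) v ⟩
  length (incident-edges (xs ++ e ∷ ys) v)                         ≡⟨ cong length (filter-++ _ xs (e ∷ ys)) ⟩
  length (incident-edges xs v ++ incident-edges (e ∷ ys) v)        ≡⟨ cong (λ zs → length (incident-edges xs v ++ zs)) (filter-accept (incident-at? v) ev) ⟩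
  length (incident-edges xs v ++ e ∷ incident-edges ys v)          ≡⟨ length-++ (incident-edges xs v) ⟩
  length (incident-edges xs v) + suc (length (incident-edges ys v)) ≡⟨ cong (λ k → _ + suc k) (degree≡length-incident-edges ys v) ⟨
  length (incident-edges xs v) + suc (degree ys v)                 ∎
  where open ≡-Reasoning

degree-≥2 : (xs : List (Edge n)) {ys : List (Edge n)} → Incident e v → f ∈ ys → Incident f v → 2 ≤ degree (xs ++ e ∷ ys) v
degree-≥2 xs {ys} ev f∈ys fv = subst (2 ≤_) (sym (degree-split xs ev))
  (≤-trans (s≤s (degree-pos f∈ys fv)) (m≤n+m _ (length (incident-edges xs _))))

incident-elsewhere : (xs : List (Edge n)) {ys : List (Edge n)} → Incident e v → 2 ≤ degree (xs ++ e ∷ ys) v →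
                     (∃ λ f → f ∈ xs × Incident f v) ⊎ (∃ λ f → f ∈ ys × Incident f v)
incident-elsewhere {v = v} xs ev d with incident-edges xs v in eq | subst (2 ≤_) (degree-split xs ev) d
... | f ∷ _ | _           = inj₁ (f , ∈-filter⁻ (incident-at? v) (subst (f ∈_) (sym eq) (here refl)))
... | []    | s≤s ys-pos  = inj₂ (degree-pos⁻ ys-pos)

second-incident : (L : List (Edge n)) → 2 ≤ degree L v →
  ∃ λ xs → ∃ λ e → ∃ λ ys → L ≡ xs ++ e ∷ ys × Incident e v × ∃ λ f → f ∈ ys × Incident f v
second-incident {v = v} L d with degree-pos⁻ (≤-trans (s≤s z≤n) d)
... | e , e∈L , ev with split-at-first (incident-at? v) L (lose e∈L ev)
...   | xs , e′ , ys , refl , none , e′v with incident-elsewhere xs e′v d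
...     | inj₁ (f , f∈xs , fv) = ⊥-elim (All.lookup none f∈xs fv)
...     | inj₂ later          = xs , e′ , ys , refl , e′v , later

leaves-span : Connected L → (a , b) ∈ L → IsLeaf L a → IsLeaf L b → (c : Fin n) → c ≡ a ⊎ c ≡ b
leaves-span {L = L} {a = a} {b = b} connected ab∈L a-leaf b-leaf c = go (inj₁ refl) (connected a c)
  where
  leaf : x ≡ a ⊎ x ≡ b → IsLeaf L x
  leaf (inj₁ refl) = a-leaf
  leaf (inj₂ refl) = b-leaf
  on-ab : x ≡ a ⊎ x ≡ b → Incident (a , b) x
  on-ab (inj₁ refl) = inj₁ refl
  on-ab (inj₂ refl) = inj₂ refl
  go : x ≡ a ⊎ x ≡ b → Star (Adj L) x y → y ≡ a ⊎ y ≡ b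
  go x∈ab ε = x∈ab
  go x∈ab (s ◅ st) with Adj⇒SameEdge s
  ... | f , f∈L , f≈xy with leaf-edge-unique (leaf x∈ab) ab∈L f∈L (on-ab x∈ab) (SameEdge⇒incidentˡ f≈xy)
  ...   | refl = go (Sum.map sym sym (SameEdge⇒incidentʳ f≈xy)) st

leaf-degree≱2 : IsLeaf L v → ¬ 2 ≤ degree L v
leaf-degree≱2 leaf d with subst (2 ≤_) leaf d
... | s≤s ()

connected-degree-pos : Connected L → e ∈ L → (v : Fin n) → 1 ≤ degree L v
connected-degree-pos {e = e} connected e∈L v with connected v (proj₁ e)
... | ε     = degree-pos e∈L (inj₁ refl)
... | s ◅ _ = let f , f∈L , f≈ = Adj⇒SameEdge s in degree-pos f∈L (SameEdge⇒incidentˡ f≈)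

-- A caterpillar has a chain ordering

-- Twice the index of the first spine vertex on e, plus one if e also contains the next spine vertex:
-- sorting by this key walks along the spine, each spine edge between the legs at its two ends.
spine-key : List (Fin n) → Edge n → ℕ
spine-key []           e = 0
spine-key (p ∷ [])     e = 0
spine-key (p ∷ q ∷ ps) e = step (incident? e p) (incident? e q) (spine-key (q ∷ ps) e)
  where
  step : {B C : Set} → Dec B → Dec C → ℕ → ℕ
  step (yes _) (yes _) _ = 1
  step (yes _) (no _)  _ = 0
  step (no _)  _       k = 2 + k

module _ {p q : Fin n} {ps : List (Fin n)} where

  spine-key-both : Incident e p → Incident e q → spine-key (p ∷ q ∷ ps) e ≡ 1
  spine-key-both {e = e} ep eq with incident? e p | incident? e q
  ... | yes _ | yes _ = refl
  ... | yes _ | no ¬eq = ⊥-elim (¬eq eq)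
  ... | no ¬ep | _     = ⊥-elim (¬ep ep)

  spine-key-first : Incident e p → ¬ Incident e q → spine-key (p ∷ q ∷ ps) e ≡ 0
  spine-key-first {e = e} ep ¬eq with incident? e p | incident? e q
  ... | yes _  | yes eq = ⊥-elim (¬eq eq)
  ... | yes _  | no _   = refl
  ... | no ¬ep | _      = ⊥-elim (¬ep ep)

  spine-key-skip : ¬ Incident e p → spine-key (p ∷ q ∷ ps) e ≡ 2 + spine-key (q ∷ ps) e
  spine-key-skip {e = e} ¬ep with incident? e p
  ... | yes ep = ⊥-elim (¬ep ep)
  ... | no _   = refl

spine-key-++ : (pre : List (Fin n)) {s : Fin n} {S : List (Fin n)} → All (¬_ ∘ Incident e) pre →
               spine-key (pre ++ s ∷ S) e ≡ length pre * 2 + spine-key (s ∷ S) e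
spine-key-++ []             _               = refl
spine-key-++ (p ∷ [])       {s} {S} (¬ep ∷ _) = spine-key-skip {ps = S} ¬ep
spine-key-++ (p ∷ p′ ∷ pre) {s} {S} (¬ep ∷ ¬e-pre) =
  trans (spine-key-skip {ps = pre ++ s ∷ S} ¬ep) (cong (2 +_) (spine-key-++ (p′ ∷ pre) ¬e-pre))

IncidentToSome : List (Fin n) → Edge n → Set
IncidentToSome {n} S e = Σ (Fin n) λ s → s ∈ S × Incident e s

all-leaves-chain : (L : List (Edge n)) → Connected L → (∀ v → IsLeaf L v) → Chain L
all-leaves-chain []                    _         _    = []
all-leaves-chain (e ∷ [])              _         _    = [-]
all-leaves-chain ((a , b) ∷ (c , d) ∷ L) connected leaf with leaves-span connected (here refl) (leaf a) (leaf b) c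
... | inj₁ refl = ⊥-elim (leaf-degree≱2 {L = (a , b) ∷ (a , d) ∷ L} (leaf a)
                                      (degree-≥2 {e = a , b} [] {(a , d) ∷ L} (inj₁ refl) (here refl) (inj₁ refl)))
... | inj₂ refl = ⊥-elim (leaf-degree≱2 {L = (a , b) ∷ (b , d) ∷ L} (leaf b)
                                      (degree-≥2 {e = a , b} [] {(b , d) ∷ L} (inj₂ refl) (here refl) (inj₁ refl)))

module CaterpillarChain {E : List (Edge n)} (connected : Connected E) {P : List (Fin n)} (P-unique : Unique P)
  (P-spine : (v : Fin n) → (v ∈ P) ⇔ (¬ IsLeaf E v))
  (P-path : (u v : Fin n) → ¬ IsLeaf E u → ¬ IsLeaf E v → Adj E u v ⇔ Consecutive P u v) where

  off-spine⇒leaf : v ∉ P → IsLeaf E v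
  off-spine⇒leaf {v = v} v∉P with degree E v ℕ.≟ 1
  ... | yes leaf = leaf
  ... | no ¬leaf = ⊥-elim (v∉P (Equivalence.from (P-spine v) ¬leaf))

  touches-spine : {p : Fin n} {ps : List (Fin n)} → P ≡ p ∷ ps → e ∈ E → IncidentToSome P e
  touches-spine {e = a , b} {p = p} P≡p∷ps ab∈E with any? (a ≟_) P | any? (b ≟_) P
  ... | yes a∈P | _       = a , a∈P , inj₁ refl
  ... | no _    | yes b∈P = b , b∈P , inj₂ refl
  ... | no a∉P  | no b∉P  with leaves-span connected ab∈E (off-spine⇒leaf a∉P) (off-spine⇒leaf b∉P) p
  ...   | inj₁ refl = ⊥-elim (a∉P (subst (p ∈_) (sym P≡p∷ps) (here refl)))
  ...   | inj₂ refl = ⊥-elim (b∉P (subst (p ∈_) (sym P≡p∷ps) (here refl)))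

  spine-edge : (pre : List (Fin n)) {x y : Fin n} {S : List (Fin n)} → P ≡ pre ++ x ∷ y ∷ S →
               ∃ λ g → g ∈ E × SameEdge g (x , y) × All (¬_ ∘ Incident g) pre
  spine-edge pre {x} {y} {S} P≡ =
    let g , g∈E , g≈xy = Adj⇒SameEdge (Equivalence.from (P-path x y (inner (∈-insert pre)) (inner (∈-++⁺ʳ pre (there (here refl)))))
                                                       (pre , S , inj₁ P≡))
    in g , g∈E , g≈xy , All.tabulate λ z∈pre gz → off-pre (SameEdge-incident⁻ g≈xy gz) z∈pre
    where
    inner : v ∈ pre ++ x ∷ y ∷ S → ¬ IsLeaf E v
    inner v∈ = Equivalence.to (P-spine _) (subst (_ ∈_) (sym P≡) v∈)
    off-pre : z ≡ x ⊎ z ≡ y → z ∉ pre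
    off-pre (inj₁ refl) = Unique-++-apart pre (subst Unique P≡ P-unique) (here refl)
    off-pre (inj₂ refl) = Unique-++-apart pre (subst Unique P≡ P-unique) (there (here refl))

  key : Edge n → ℕ
  key = spine-key P

  open Sort (On.decTotalOrder ≤-decTotalOrder key) using (sort; sort-↭; sort-↗)

  NothingBetween : Edge n → Edge n → Set
  NothingBetween e f = ∀ {g} → g ∈ E → key e < key g → key g < key f → ⊥

  suffix-between : (pre : List (Fin n)) {s : Fin n} {S : List (Fin n)} → P ≡ pre ++ s ∷ S → NothingBetween e f →
    g ∈ E → All (¬_ ∘ Incident e) pre → All (¬_ ∘ Incident g) pre → All (¬_ ∘ Incident f) pre →
    spine-key (s ∷ S) e < spine-key (s ∷ S) g → spine-key (s ∷ S) g < spine-key (s ∷ S) f → ⊥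
  suffix-between pre {s} {S} P≡ gap g∈E e-pre g-pre f-pre e<g g<f = gap g∈E (shift e-pre g-pre e<g) (shift g-pre f-pre g<f)
    where
    key-shift : {h : Edge n} → All (¬_ ∘ Incident h) pre → key h ≡ length pre * 2 + spine-key (s ∷ S) h
    key-shift {h} h-pre = trans (cong (λ Q → spine-key Q h) P≡) (spine-key-++ pre h-pre)
    shift : {h k : Edge n} → All (¬_ ∘ Incident h) pre → All (¬_ ∘ Incident k) pre →
            spine-key (s ∷ S) h < spine-key (s ∷ S) k → key h < key k
    shift h-pre k-pre lt = subst₂ _<_ (sym (key-shift h-pre)) (sym (key-shift k-pre)) (+-monoʳ-< (length pre * 2) lt)

  -- The spine edge qr sorts strictly between e and f.
  second-spine-edge-between : (pre : List (Fin n)) {p q : Fin n} {S : List (Fin n)} → P ≡ pre ++ p ∷ q ∷ S →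
    NothingBetween e f → All (¬_ ∘ Incident e) pre → All (¬_ ∘ Incident f) pre → IncidentToSome (p ∷ q ∷ S) f →
    Incident e p → Incident e q → ¬ Incident f p → ¬ Incident f q → ⊥
  second-spine-edge-between pre _ _ _ _ (_ , here refl , fp)         _ _ ¬fp _   = ¬fp fp
  second-spine-edge-between pre _ _ _ _ (_ , there (here refl) , fq) _ _ _   ¬fq = ¬fq fq
  second-spine-edge-between {f = f} pre {p} {q} {r ∷ S} P≡ gap e-pre f-pre (_ , there (there _) , _) ep eq ¬fp ¬fq
    with spine-edge (pre ++ p ∷ []) (trans P≡ (sym (++-assoc pre (p ∷ []) (q ∷ r ∷ S))))
  ... | g , g∈E , g≈qr , g-pre-p = suffix-between pre P≡ gap g∈E e-pre (All.++⁻ˡ pre g-pre-p) f-pre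
          (subst₂ _<_ (sym (spine-key-both {ps = r ∷ S} ep eq)) (sym key-g) (s≤s (s≤s z≤n)))
          (subst₂ _<_ (sym key-g) (sym key-f) (s≤s (s≤s (s≤s (s≤s z≤n)))))
    where
    ¬gp : ¬ Incident g p
    ¬gp = All.lookup g-pre-p (∈-insert pre)
    key-g : spine-key (p ∷ q ∷ r ∷ S) g ≡ 3
    key-g = trans (spine-key-skip {ps = r ∷ S} ¬gp) (cong (2 +_) (spine-key-both {ps = S} (SameEdge⇒incidentˡ g≈qr) (SameEdge⇒incidentʳ g≈qr)))
    key-f : spine-key (p ∷ q ∷ r ∷ S) f ≡ 4 + spine-key (r ∷ S) f
    key-f = trans (spine-key-skip {ps = r ∷ S} ¬fp) (cong (2 +_) (spine-key-skip {ps = S} ¬fq))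

  -- Unless e and f meet at q, a spine edge sorts strictly between them.
  leaving-edges-meet : (pre : List (Fin n)) {p q : Fin n} {S : List (Fin n)} → P ≡ pre ++ p ∷ q ∷ S →
    NothingBetween e f → All (¬_ ∘ Incident e) pre → All (¬_ ∘ Incident f) pre → IncidentToSome (p ∷ q ∷ S) f →
    Incident e p → ¬ Incident f p → Meet e f
  leaving-edges-meet {e = e} {f = f} pre {p} {q} {S} P≡ gap e-pre f-pre f-S ep ¬fp with incident? e q | incident? f q
  ... | yes eq | yes fq  = q , eq , fq
  ... | yes eq | no ¬fq  = ⊥-elim (second-spine-edge-between pre P≡ gap e-pre f-pre f-S ep eq ¬fp ¬fq)
  ... | no ¬eq | _ with spine-edge pre P≡
  ...   | g , g∈E , g≈pq , g-pre = ⊥-elim (suffix-between pre P≡ gap g∈E e-pre g-pre f-pre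
            (subst₂ _<_ (sym (spine-key-first {ps = S} ep ¬eq)) (sym key-g) (s≤s z≤n))
            (subst₂ _<_ (sym key-g) (sym (spine-key-skip {ps = S} ¬fp)) (s≤s (s≤s z≤n))))
    where
    key-g : spine-key (p ∷ q ∷ S) g ≡ 1
    key-g = spine-key-both {ps = S} (SameEdge⇒incidentˡ g≈pq) (SameEdge⇒incidentʳ g≈pq)

  MeetsAlong : List (Fin n) → List (Fin n) → Edge n → Edge n → Set
  MeetsAlong pre S e f = All (¬_ ∘ Incident e) pre → All (¬_ ∘ Incident f) pre →
    IncidentToSome S e → IncidentToSome S f → spine-key S e ≤ spine-key S f → Meet e f

  meet-at-head : (pre : List (Fin n)) {p q : Fin n} {S : List (Fin n)} → P ≡ pre ++ p ∷ q ∷ S → NothingBetween e f →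
                 MeetsAlong (pre ++ p ∷ []) (q ∷ S) e f → MeetsAlong pre (p ∷ q ∷ S) e f
  meet-at-head {e = e} {f = f} pre {p} {q} {S} P≡ gap further e-pre f-pre e-S f-S e≤f with incident? e p | incident? f p
  ... | yes ep | yes fp = p , ep , fp
  ... | yes ep | no ¬fp = leaving-edges-meet pre P≡ gap e-pre f-pre f-S ep ¬fp
  ... | no ¬ep | yes fp with incident? f q
  ...   | yes _ = case e≤f of λ { (s≤s ()) }
  ...   | no _  = case e≤f of λ ()
  meet-at-head {e = e} {f = f} pre {p} {q} {S} P≡ gap further e-pre f-pre e-S f-S e≤f | no ¬ep | no ¬fp =
    further (All.++⁺ e-pre (¬ep ∷ [])) (All.++⁺ f-pre (¬fp ∷ [])) (beyond e-S ¬ep) (beyond f-S ¬fp) (≤-pred (≤-pred e≤f))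
    where
    beyond : {h : Edge n} → IncidentToSome (p ∷ q ∷ S) h → ¬ Incident h p → IncidentToSome (q ∷ S) h
    beyond (_ , here refl , hp) ¬hp = ⊥-elim (¬hp hp)
    beyond (s , there s∈ , hs)  _   = s , s∈ , hs

  meet-along : (pre S : List (Fin n)) → P ≡ pre ++ S → NothingBetween e f → MeetsAlong pre S e f
  meet-along pre (p ∷ []) _ _ _ _ (_ , here refl , ep) (_ , here refl , fp) _ = p , ep , fp
  meet-along pre (p ∷ q ∷ S) P≡ gap =
    meet-at-head pre P≡ gap (meet-along (pre ++ p ∷ []) (q ∷ S) (trans P≡ (sym (++-assoc pre (p ∷ []) (q ∷ S)))) gap)

  sorted-chain : {p : Fin n} {ps : List (Fin n)} → P ≡ p ∷ ps → Chain (sort E)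
  sorted-chain P≡p∷ps = Linked-consecutive⁺ (sort E) λ xs e f ys O≡ →
    let sorted = subst (AllPairs _) O≡ (Linked⇒AllPairs ≤-trans (sort-↗ E))
        in-E : ∀ {g} → g ∈ xs ++ e ∷ f ∷ ys → g ∈ E
        in-E g∈ = ∈-resp-↭ (sort-↭ E) (subst (_ ∈_) (sym O≡) g∈)
    in meet-along [] P refl (nothing-between xs O≡ sorted) [] []
                  (touches-spine P≡p∷ps (in-E (∈-insert xs))) (touches-spine P≡p∷ps (in-E (∈-++⁺ʳ xs (there (here refl)))))
                  (All.head (AllPairs-middle xs sorted))
    where
    nothing-between : (xs : List (Edge n)) {e f : Edge n} {ys : List (Edge n)} → sort E ≡ xs ++ e ∷ f ∷ ys →
                      AllPairs (λ g h → key g ≤ key h) (xs ++ e ∷ f ∷ ys) → NothingBetween e f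
    nothing-between xs O≡ sorted g∈E e<g g<f
      with sorted-outside key xs sorted (subst (_ ∈_) O≡ (∈-resp-↭ (↭-sym (sort-↭ E)) g∈E))
    ... | inj₁ g≤e = <⇒≱ e<g g≤e
    ... | inj₂ f≤g = <⇒≱ g<f f≤g

  caterpillar-chain : ∃ λ O → O ↭ E × Chain O
  caterpillar-chain = by-spine P refl
    where
    by-spine : (Q : List (Fin n)) → P ≡ Q → ∃ λ O → O ↭ E × Chain O
    by-spine []       P≡[] =
      E , ↭-refl , all-leaves-chain E connected (λ v → off-spine⇒leaf (λ v∈P → case subst (v ∈_) P≡[] v∈P of λ ()))
    by-spine (p ∷ ps) P≡   = sort E , sort-↭ E , sorted-chain P≡

-- A tree with a chain ordering is a caterpillar

derun-∷ : (x : Fin n) (xs : List (Fin n)) → ∃ λ pre → derun _≟_ (x ∷ xs) ≡ pre ++ derun _≟_ xs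
derun-∷ x []      = x ∷ [] , refl
derun-∷ x (y ∷ xs) with x ≟ y
... | yes _ = [] , refl
... | no _  = x ∷ [] , refl

derun-head : (x : Fin n) (xs : List (Fin n)) → ∃ λ t → derun _≟_ (x ∷ xs) ≡ x ∷ t
derun-head x []       = [] , refl
derun-head x (y ∷ xs) with x ≟ y
... | yes refl = derun-head x xs
... | no _     = derun _≟_ (y ∷ xs) , refl

-- Stated for a nonempty list so that the recursion stays structural under the with.
derun-∷-consecutive⁻ : (x : Fin n) (H xs : List (Fin n)) {ys : List (Fin n)} → derun _≟_ (x ∷ H) ≡ xs ++ u ∷ v ∷ ys →
                     ∃ λ as → ∃ λ bs → x ∷ H ≡ as ++ u ∷ v ∷ bs
derun-∷-consecutive⁻ x []      []            ()
derun-∷-consecutive⁻ x []      (_ ∷ [])      ()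
derun-∷-consecutive⁻ x []      (_ ∷ _ ∷ _)   ()
derun-∷-consecutive⁻ x (y ∷ H) xs eq with x ≟ y
... | yes _ = let as , bs , H≡ = derun-∷-consecutive⁻ y H xs eq in x ∷ as , bs , cong (x ∷_) H≡
derun-∷-consecutive⁻ x (y ∷ H) [] eq | no _ with derun-head y H | ∷-injective eq
... | t , head≡ | refl , rest≡ with ∷-injectiveˡ (trans (sym head≡) rest≡)
...   | refl = [] , H , refl
derun-∷-consecutive⁻ x (y ∷ H) (_ ∷ xs) eq | no _ =
  let as , bs , H≡ = derun-∷-consecutive⁻ y H xs (∷-injectiveʳ eq) in x ∷ as , bs , cong (x ∷_) H≡

derun-consecutive⁻ : (H xs : List (Fin n)) {ys : List (Fin n)} → derun _≟_ H ≡ xs ++ u ∷ v ∷ ys →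
                     ∃ λ as → ∃ λ bs → H ≡ as ++ u ∷ v ∷ bs
derun-consecutive⁻ []      []      ()
derun-consecutive⁻ []      (_ ∷ _) ()
derun-consecutive⁻ (x ∷ H) xs      eq = derun-∷-consecutive⁻ x H xs eq

derun-consecutive⁺ : (as : List (Fin n)) {bs : List (Fin n)} → u ≢ v →
                     ∃ λ xs → ∃ λ ys → derun _≟_ (as ++ u ∷ v ∷ bs) ≡ xs ++ u ∷ v ∷ ys
derun-consecutive⁺ [] {bs} u≢v =
  let t , head≡ = derun-head _ bs in [] , t , trans (derun-accept _≟_ bs u≢v) (cong (_ ∷_) head≡)
derun-consecutive⁺ (a ∷ as) {bs} u≢v =
  let pre , derun≡ = derun-∷ a (as ++ _ ∷ _ ∷ bs)
      xs , ys , rest≡ = derun-consecutive⁺ as {bs} u≢v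
  in pre ++ xs , ys , trans derun≡ (trans (cong (pre ++_) rest≡) (sym (++-assoc pre xs _)))

NoReturn : List (Fin n) → Set
NoReturn {n} H = ∀ (as : List (Fin n)) x y cs ds → x ≢ y → H ≢ as ++ x ∷ y ∷ cs ++ x ∷ ds

NoReturn-tail : NoReturn (x ∷ H) → NoReturn H
NoReturn-tail {x = x} no-return as y z cs ds y≢z eq = no-return (x ∷ as) y z cs ds y≢z (cong (x ∷_) eq)

derun-∷-unique : (x : Fin n) (H : List (Fin n)) → NoReturn (x ∷ H) → Unique (derun _≟_ (x ∷ H))
derun-∷-unique x []      _         = [] ∷ []
derun-∷-unique x (y ∷ H) no-return with x ≟ y
... | yes _  = derun-∷-unique y H (NoReturn-tail no-return)
... | no x≢y = ¬Any⇒All¬ _ (x∉ ∘ ∈-derun⁻ _≟_ (y ∷ H)) ∷ derun-∷-unique y H (NoReturn-tail no-return)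
  where
  x∉ : x ∉ y ∷ H
  x∉ (here x≡y)  = x≢y x≡y
  x∉ (there x∈H) = let cs , ds , H≡ = ∈-∃++ x∈H in no-return [] x y cs ds x≢y (cong (λ t → x ∷ y ∷ t) H≡)

derun-unique : (H : List (Fin n)) → NoReturn H → Unique (derun _≟_ H)
derun-unique []      _         = []
derun-unique (x ∷ H) no-return = derun-∷-unique x H no-return

hinge : Edge n → Edge n → Fin n
hinge (a , b) f with incident? f a
... | yes _ = a
... | no _  = b

hinge-incident : Meet e f → Incident e (hinge e f) × Incident f (hinge e f)
hinge-incident {e = a , b} {f = f} (z , ez , fz) with incident? f a
... | yes fa = inj₁ refl , fa
... | no ¬fa with ez
...   | inj₁ refl = ⊥-elim (¬fa fz)
...   | inj₂ refl = inj₂ refl , fz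

hinge-unique : ¬ SameEdge e f → Meet e f → Incident e x → Incident f x → hinge e f ≡ x
hinge-unique e≉f e~f ex fx = let eh , fh = hinge-incident e~f in meet-unique e≉f eh fh ex fx

hinges : List (Edge n) → List (Fin n)
hinges []          = []
hinges (e ∷ [])    = []
hinges (e ∷ f ∷ O) = hinge e f ∷ hinges (f ∷ O)

hinges⁻ : (O : List (Edge n)) (as : List (Fin n)) {rest : List (Fin n)} → hinges O ≡ as ++ x ∷ rest →
          ∃ λ xs → ∃ λ e → ∃ λ f → ∃ λ ys → O ≡ xs ++ e ∷ f ∷ ys × hinge e f ≡ x × hinges (f ∷ ys) ≡ rest
hinges⁻ (e ∷ f ∷ O) []       eq = [] , e , f , O , refl , ∷-injectiveˡ eq , ∷-injectiveʳ eq
hinges⁻ (e ∷ f ∷ O) (_ ∷ as) eq =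
  let xs , e′ , f′ , ys , O≡ , hinge≡ , rest≡ = hinges⁻ (f ∷ O) as (∷-injectiveʳ eq)
  in e ∷ xs , e′ , f′ , ys , cong (e ∷_) O≡ , hinge≡ , rest≡

hinges-++ : (xs : List (Edge n)) (e f : Edge n) (ys : List (Edge n)) →
            ∃ λ as → hinges (xs ++ e ∷ f ∷ ys) ≡ as ++ hinge e f ∷ hinges (f ∷ ys)
hinges-++ []            e f ys = [] , refl
hinges-++ (x ∷ [])      e f ys = hinge x e ∷ [] , refl
hinges-++ (x ∷ x′ ∷ xs) e f ys = let as , eq = hinges-++ (x′ ∷ xs) e f ys in hinge x x′ ∷ as , cong (hinge x x′ ∷_) eq

module ChainFacts {O : List (Edge n)} (simple : IsSimple O) (acyclic : ¬ HasCycle O) (chain : Chain O) where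

  later-distinct : (xs : List (Edge n)) {ys : List (Edge n)} → O ≡ xs ++ e ∷ ys → f ∈ ys → ¬ SameEdge e f
  later-distinct xs O≡ f∈ys = All.lookup (AllPairs-middle xs (subst (AllPairs _) O≡ (proj₂ simple))) f∈ys

  consecutive-meet : (xs : List (Edge n)) {ys : List (Edge n)} → O ≡ xs ++ e ∷ f ∷ ys → Meet e f
  consecutive-meet xs O≡ = Linked-consecutive⁻ xs (subst Chain O≡ chain)

  consecutive-hinge : (xs : List (Edge n)) {ys : List (Edge n)} → O ≡ xs ++ e ∷ f ∷ ys →
                      Incident e x → Incident f x → hinge e f ≡ x
  consecutive-hinge xs O≡ = hinge-unique (later-distinct xs O≡ (here refl)) (consecutive-meet xs O≡)

  edge-walk : g ∈ O → ¬ Incident g v → Incident g x → Incident g y → Σ (Walk O x y) (Avoids v)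
  edge-walk {x = x} {y = y} g∈O ¬gv gx gy with x ≟ y
  ... | yes refl = ε , (λ { refl → ¬gv gx }) ∷ []
  ... | no x≢y   = SameEdge⇒Adj g∈O (incident²⇒SameEdge gx gy x≢y) ◅ ε ,
                   (λ { refl → ¬gv gx }) ∷ (λ { refl → ¬gv gy }) ∷ []

  walk-along-block : (gs : List (Edge n)) {zs : List (Edge n)} → Linked Meet (g ∷ gs ++ f ∷ zs) → g ∷ gs ⊆ O →
                     All (λ h → ¬ Incident h v) (g ∷ gs) → Incident g x → ∃ λ y → Incident f y × Σ (Walk O x y) (Avoids v)
  walk-along-block [] ((y , gy , fy) ∷ _) ⊆O (¬gv ∷ []) gx = y , fy , edge-walk (⊆O (here refl)) ¬gv gx gy
  walk-along-block (g′ ∷ gs) ((y , gy , g′y) ∷ l) ⊆O (¬gv ∷ avoid) gx =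
    let z , fz , W , W-avoids = walk-along-block gs l (⊆O ∘ there) avoid g′y
        W₀ , W₀-avoids        = edge-walk (⊆O (here refl)) ¬gv gx gy
    in z , fz , W₀ ◅◅ W , avoids-◅◅ W₀ W W₀-avoids W-avoids

  block-avoiding : (xs gs : List (Edge n)) {zs : List (Edge n)} → O ≡ xs ++ e ∷ g ∷ gs ++ f ∷ zs →
                   All (λ h → ¬ Incident h v) (g ∷ gs) → Incident e v → Incident f v → ⊥
  block-avoiding {e = e} {g = g} {f = f} {v = v} xs gs {zs} O≡ avoid ev fv =
    let a , ea , ga           = Linked.head segment
        b , fb , W , W-avoids = walk-along-block gs (Linked.tail segment) (λ h∈ → in-O (there (∈-++⁺ˡ h∈))) avoid ga
    in closing-walk acyclic (in-O (here refl)) (in-O (∈-insert (e ∷ g ∷ gs))) (later-distinct xs O≡ (∈-insert (g ∷ gs)))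
                    (incident²⇒SameEdge ev ea (All.head W-avoids ∘ sym)) (incident²⇒SameEdge fv fb (avoids-end W W-avoids ∘ sym))
                    W W-avoids
    where
    segment : Linked Meet (e ∷ g ∷ gs ++ f ∷ zs)
    segment = Linked-++⁻ʳ xs (subst Chain O≡ chain)
    in-O : {h : Edge n} → h ∈ e ∷ g ∷ gs ++ f ∷ zs → h ∈ O
    in-O h∈ = subst (_ ∈_) (sym O≡) (∈-++⁺ʳ xs h∈)

  incident-block : (xs ms : List (Edge n)) {zs : List (Edge n)} → O ≡ xs ++ e ∷ ms ++ f ∷ zs →
                   Incident e v → Incident f v → All (λ h → Incident h v) ms
  incident-block xs []       _  _  _  = []
  incident-block {e = e} {f = f} {v = v} xs (m ∷ ms) {zs} O≡ ev fv with incident? m v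
  ... | yes mv = mv ∷ incident-block (xs ++ e ∷ []) ms (trans O≡ (sym (++-assoc xs (e ∷ []) _))) mv fv
  ... | no ¬mv =
    let gs , f′ , zs′ , rest≡ , avoid , f′v = split-at-first (incident-at? v) (ms ++ f ∷ zs) (lose (∈-insert ms) fv)
    in ⊥-elim (block-avoiding xs gs (trans O≡ (cong (λ t → xs ++ e ∷ m ∷ t) rest≡)) (¬mv ∷ avoid) ev f′v)

  next-incident : (xs : List (Edge n)) {ys : List (Edge n)} → O ≡ xs ++ e ∷ ys → Incident e v → f ∈ ys → Incident f v →
                  ∃ λ y → ∃ λ ys′ → ys ≡ y ∷ ys′ × Incident y v
  next-incident xs {y ∷ ys′} O≡ ev (here refl) fv = y , ys′ , refl , fv
  next-incident xs {y ∷ ys′} O≡ ev (there f∈)  fv =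
    let cs , ds , ys′≡ = ∈-∃++ f∈
    in y , ys′ , refl , All.head (incident-block xs (y ∷ cs) (trans O≡ (cong (λ t → xs ++ _ ∷ y ∷ t) ys′≡)) ev fv)

  previous-incident : (xs : List (Edge n)) {ys : List (Edge n)} → O ≡ xs ++ e ∷ ys → Incident e v → f ∈ xs → Incident f v →
                      ∃ λ xs′ → ∃ λ x → xs ≡ xs′ ∷ʳ x × Incident x v
  previous-incident {e = e} {f = f} xs {ys} O≡ ev f∈ fv with ∈-∃++ f∈
  ... | as , ms , refl =
    let ini , x , f∷ms≡ , xv = All-last f ms (fv ∷ incident-block as ms (trans O≡ (++-assoc as (f ∷ ms) (e ∷ ys))) fv ev)
    in as ++ ini , x , trans (cong (as ++_) f∷ms≡) (sym (++-assoc as ini (x ∷ []))) , xv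

  -- If x = hinge e f, y = hinge f g and x recurs later, the block of edges at x runs from f past g,
  -- so f and g share both x and y.
  hinges-no-return : NoReturn (hinges O)
  hinges-no-return as x y cs ds x≢y H≡ with hinges⁻ O as H≡
  ... | xs , e , f , [] , O≡ , _ , ()
  ... | xs , e , f , g ∷ ys , O≡ , hinge-ef , rest≡ with hinges⁻ (g ∷ ys) cs (∷-injectiveʳ rest≡)
  ...   | zs , k , k′ , ys′ , g∷ys≡ , hinge-kk′ , _ =
    x≢y (meet-unique (later-distinct (xs ++ e ∷ []) O≡fg (here refl)) fx (g-at-x zs g∷ys≡ x-block) fy gy)
    where
    O≡fg : O ≡ (xs ++ e ∷ []) ++ f ∷ g ∷ ys
    O≡fg = trans O≡ (sym (++-assoc xs (e ∷ []) (f ∷ g ∷ ys)))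
    O≡k : O ≡ (xs ++ e ∷ []) ++ f ∷ zs ++ k ∷ k′ ∷ ys′
    O≡k = trans O≡fg (cong (λ t → (xs ++ e ∷ []) ++ f ∷ t) g∷ys≡)
    fx : Incident f x
    fx = subst (Incident f) hinge-ef (proj₂ (hinge-incident (consecutive-meet xs O≡)))
    fy : Incident f y
    fy = subst (Incident f) (∷-injectiveˡ rest≡) (proj₁ (hinge-incident (consecutive-meet (xs ++ e ∷ []) O≡fg)))
    gy : Incident g y
    gy = subst (Incident g) (∷-injectiveˡ rest≡) (proj₂ (hinge-incident (consecutive-meet (xs ++ e ∷ []) O≡fg)))
    kx : Incident k x
    kx = subst (Incident k) hinge-kk′
           (proj₁ (hinge-incident (consecutive-meet ((xs ++ e ∷ []) ++ f ∷ zs) (trans O≡k (sym (++-assoc (xs ++ e ∷ []) (f ∷ zs) _))))))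
    x-block : All (λ h → Incident h x) zs
    x-block = incident-block (xs ++ e ∷ []) zs O≡k fx kx
    g-at-x : (zs : List (Edge n)) → g ∷ ys ≡ zs ++ k ∷ k′ ∷ ys′ → All (λ h → Incident h x) zs → Incident g x
    g-at-x []      eq _        = subst (λ h → Incident h x) (sym (∷-injectiveˡ eq)) kx
    g-at-x (_ ∷ _) eq (hx ∷ _) = subst (λ h → Incident h x) (sym (∷-injectiveˡ eq)) hx

module ChainSpine {E O : List (Edge n)} (tree : IsTree E) (O↭E : O ↭ E) (chain : Chain O) {e₀ : Edge n} (e₀∈E : e₀ ∈ E) where

  open ChainFacts (ordering-simple tree O↭E) (ordering-acyclic tree O↭E) chain

  spine : List (Fin n)
  spine = derun _≟_ (hinges O)

  spine-unique : Unique spine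
  spine-unique = derun-unique (hinges O) hinges-no-return

  non-leaf⇒degree≥2 : ¬ IsLeaf E v → 2 ≤ degree O v
  non-leaf⇒degree≥2 {v = v} ¬leaf =
    subst (2 ≤_) (sym (degree-resp-↭ O↭E v)) (≤∧≢⇒< (connected-degree-pos (proj₁ (proj₂ tree)) e₀∈E v) (¬leaf ∘ sym))

  on-spine⇒non-leaf : v ∈ spine → ¬ IsLeaf E v
  on-spine⇒non-leaf {v = v} v∈ leaf =
    let as , _ , H≡                       = ∈-∃++ (∈-derun⁻ _≟_ (hinges O) v∈)
        xs , e , f , ys , O≡ , hinge≡ , _ = hinges⁻ O as H≡
        eh , fh                           = hinge-incident (consecutive-meet xs O≡)
    in leaf-degree≱2 {L = E} leaf (subst (2 ≤_) (trans (cong (λ L → degree L v) (sym O≡)) (degree-resp-↭ O↭E v))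
                                  (degree-≥2 xs (subst (Incident e) hinge≡ eh) (here refl) (subst (Incident f) hinge≡ fh)))

  non-leaf⇒on-spine : ¬ IsLeaf E v → v ∈ spine
  non-leaf⇒on-spine {v = v} ¬leaf with second-incident O (non-leaf⇒degree≥2 ¬leaf)
  ... | xs , e , ys , O≡ , ev , g , g∈ys , gv with next-incident xs O≡ ev g∈ys gv
  ...   | y , ys′ , refl , yv =
    let as , H≡ = hinges-++ xs e y ys′
    in ∈-derun⁺ _≟_ (subst (v ∈_) (sym (trans (cong hinges O≡) H≡))
                           (subst (λ h → v ∈ as ++ h ∷ hinges (y ∷ ys′)) (sym (consecutive-hinge xs O≡ ev yv)) (∈-insert as)))

  spine-consecutive⇒adjacent : (xs : List (Fin n)) {ys : List (Fin n)} → spine ≡ xs ++ u ∷ v ∷ ys → Adj O u v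
  spine-consecutive⇒adjacent {u = u} {v = v} xs spine≡ with derun-consecutive⁻ (hinges O) xs spine≡
  ... | as , bs , H≡ with hinges⁻ O as H≡
  ...   | xs′ , e , f , [] , _ , _ , ()
  ...   | xs′ , e , f , g ∷ ys′ , O≡ , hinge-ef , rest≡ =
    SameEdge⇒Adj (subst (f ∈_) (sym O≡) (∈-++⁺ʳ xs′ (there (here refl)))) (incident²⇒SameEdge fu fv u≢v)
    where
    O≡fg : O ≡ (xs′ ++ e ∷ []) ++ f ∷ g ∷ ys′
    O≡fg = trans O≡ (sym (++-assoc xs′ (e ∷ []) (f ∷ g ∷ ys′)))
    fu : Incident f u
    fu = subst (Incident f) hinge-ef (proj₂ (hinge-incident (consecutive-meet xs′ O≡)))
    fv : Incident f v
    fv = subst (Incident f) (∷-injectiveˡ rest≡) (proj₁ (hinge-incident (consecutive-meet (xs′ ++ e ∷ []) O≡fg)))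
    u≢v : u ≢ v
    u≢v with Unique-++⁻ʳ xs (subst Unique spine≡ spine-unique)
    ... | (u≢v ∷ _) ∷ _ = u≢v

  NextTo : List (Edge n) → List (Edge n) → Fin n → Set
  NextTo xs ys w = (∃ λ xs′ → ∃ λ x → xs ≡ xs′ ∷ʳ x × Incident x w) ⊎ (∃ λ y → ∃ λ ys′ → ys ≡ y ∷ ys′ × Incident y w)

  next-to : (xs : List (Edge n)) {ys : List (Edge n)} → O ≡ xs ++ e ∷ ys → ¬ IsLeaf E w → Incident e w → NextTo xs ys w
  next-to {w = w} xs O≡ ¬leaf ew with incident-elsewhere xs ew (subst (λ L → 2 ≤ degree L w) O≡ (non-leaf⇒degree≥2 ¬leaf))
  ... | inj₁ (g , g∈ , gw) = inj₁ (previous-incident xs O≡ ew g∈ gw)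
  ... | inj₂ (g , g∈ , gw) = inj₂ (next-incident xs O≡ ew g∈ gw)

  hinges-around : (xs : List (Edge n)) {x y : Edge n} {ys : List (Edge n)} → O ≡ xs ++ x ∷ e ∷ y ∷ ys → u ≢ v →
                  Incident x u → Incident e u → Incident e v → Incident y v → ∃ λ as → ∃ λ bs → spine ≡ as ++ u ∷ v ∷ bs
  hinges-around {e = e} xs {x} {y} {ys} O≡ u≢v xu eu ev yv =
    let as , H≡ = hinges-++ xs x e (y ∷ ys)
        cs , ds , derun≡ = derun-consecutive⁺ as u≢v
        hinge-xe = consecutive-hinge xs O≡ xu eu
        hinge-ey = consecutive-hinge (xs ++ x ∷ []) (trans O≡ (sym (++-assoc xs (x ∷ []) (e ∷ y ∷ ys)))) ev yv
        H≡′ = trans (cong hinges O≡) (trans H≡ (cong₂ (λ h h′ → as ++ h ∷ h′ ∷ hinges (y ∷ ys)) hinge-xe hinge-ey))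
    in cs , ds , trans (cong (derun _≟_) H≡′) derun≡

  adjacent⇒spine-consecutive : ¬ IsLeaf E u → ¬ IsLeaf E v → Adj O u v → Consecutive spine u v
  adjacent⇒spine-consecutive {u = u} {v = v} ¬leaf-u ¬leaf-v u~v with Adj⇒SameEdge u~v
  ... | e , e∈O , e≈uv with ∈-∃++ e∈O
  ...   | xs , ys , O≡ = sides (next-to xs O≡ ¬leaf-u eu) (next-to xs O≡ ¬leaf-v ev)
    where
    eu : Incident e u
    eu = SameEdge⇒incidentˡ e≈uv
    ev : Incident e v
    ev = SameEdge⇒incidentʳ e≈uv
    u≢v : u ≢ v
    u≢v = SameEdge⇒≢ (All.lookup (proj₁ (ordering-simple tree O↭E)) e∈O) e≈uv
    sides : NextTo xs ys u → NextTo xs ys v → Consecutive spine u v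
    sides (inj₂ (y , _ , ys≡ , yu)) (inj₂ (y′ , _ , ys≡′ , y′v)) =
      ⊥-elim (later-distinct xs O≡ (subst (y ∈_) (sym ys≡) (here refl))
               (SameEdge-trans e≈uv (SameEdge-sym (incident²⇒SameEdge yu (subst (λ h → Incident h v) (sym y≡y′) y′v) u≢v))))
      where
      y≡y′ : y ≡ y′
      y≡y′ = ∷-injectiveˡ (trans (sym ys≡) ys≡′)
    sides (inj₁ (xs′ , x , xs≡ , xu)) (inj₁ (xs″ , x′ , xs≡′ , x′v)) =
      ⊥-elim (later-distinct xs′ O≡′ (here refl)
               (SameEdge-trans (incident²⇒SameEdge xu (subst (λ h → Incident h v) (sym x≡x′) x′v) u≢v) (SameEdge-sym e≈uv)))
      where
      x≡x′ : x ≡ x′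
      x≡x′ = ∷ʳ-injectiveʳ xs′ xs″ (trans (sym xs≡) xs≡′)
      O≡′ : O ≡ xs′ ++ x ∷ e ∷ ys
      O≡′ = trans O≡ (trans (cong (_++ _) xs≡) (++-assoc xs′ (x ∷ []) _))
    sides (inj₁ (xs′ , x , xs≡ , xu)) (inj₂ (y , ys′ , ys≡ , yv)) =
      let as , bs , spine≡ = hinges-around xs′ (trans O≡ (trans (cong₂ (λ p q → p ++ _ ∷ q) xs≡ ys≡) (++-assoc xs′ (x ∷ []) _)))
                                           u≢v xu eu ev yv
      in as , bs , inj₁ spine≡
    sides (inj₂ (y , ys′ , ys≡ , yu)) (inj₁ (xs′ , x , xs≡ , xv)) =
      let as , bs , spine≡ = hinges-around xs′ (trans O≡ (trans (cong₂ (λ p q → p ++ _ ∷ q) xs≡ ys≡) (++-assoc xs′ (x ∷ []) _)))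
                                           (u≢v ∘ sym) xv ev eu yu
      in as , bs , inj₂ spine≡

  caterpillar : IsCaterpillar E
  caterpillar = spine , spine-unique , (λ v → mk⇔ on-spine⇒non-leaf non-leaf⇒on-spine) , λ u v ¬leaf-u ¬leaf-v →
    mk⇔ (adjacent⇒spine-consecutive ¬leaf-u ¬leaf-v ∘ Adj-mono (↭⇒⊆ (↭-sym O↭E)))
        λ { (xs , ys , inj₁ spine≡) → Adj-mono (↭⇒⊆ O↭E) (spine-consecutive⇒adjacent xs spine≡)
          ; (xs , ys , inj₂ spine≡) → Adj-mono (↭⇒⊆ O↭E) (Adj-sym (spine-consecutive⇒adjacent xs spine≡)) }

edgeless-caterpillar : Connected {suc n} [] → IsCaterpillar {suc n} []
edgeless-caterpillar connected =
  zero ∷ [] , [] ∷ [] , (λ v → mk⇔ (λ _ ()) (λ _ → here (only v))) , λ u v _ _ → mk⇔ (⊥-elim ∘ no-edge) (⊥-elim ∘ not-consecutive)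
  where
  no-edge : ¬ Adj {suc _} [] u v
  no-edge (inj₁ ())
  no-edge (inj₂ ())
  only : (v : Fin (suc _)) → v ≡ zero
  only v with connected v zero
  ... | ε     = refl
  ... | s ◅ _ = ⊥-elim (no-edge s)
  not-consecutive : ¬ Consecutive (zero ∷ []) u v
  not-consecutive ([]          , _ , inj₁ ())
  not-consecutive ([]          , _ , inj₂ ())
  not-consecutive ((_ ∷ [])    , _ , inj₁ ())
  not-consecutive ((_ ∷ [])    , _ , inj₂ ())
  not-consecutive ((_ ∷ _ ∷ _) , _ , inj₁ ())
  not-consecutive ((_ ∷ _ ∷ _) , _ , inj₂ ())

chain⇒caterpillar : {E O : List (Edge (suc n))} → IsTree E → O ↭ E → Chain O → IsCaterpillar E
chain⇒caterpillar {E = []}    (_ , connected , _) _   _     = edgeless-caterpillar connected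
chain⇒caterpillar {E = _ ∷ _} tree                O↭E chain = ChainSpine.caterpillar tree O↭E chain (here refl)

unique-product⇒caterpillar : {E O : List (Edge (suc n))} → IsTree E → O ↭ E →
                             (∀ O′ → O′ ↭ E → product O′ ≗ product O → O′ ≡ O) → IsCaterpillar E
unique-product⇒caterpillar tree O↭E unique =
  chain⇒caterpillar tree O↭E (unique-ordering⇒chain _ λ O′ O′↭O → unique O′ (↭-trans O′↭O O↭E))

caterpillar⇒unique-product : {E : List (Edge (suc n))} → IsTree E → IsCaterpillar E →
                             ∃ λ O → O ↭ E × (∀ O′ → O′ ↭ E → product O′ ≗ product O → O′ ≡ O)
caterpillar⇒unique-product tree@(_ , connected , _) (P , P-unique , P-spine , P-path) =
  let O , O↭E , chain = CaterpillarChain.caterpillar-chain connected P-unique P-spine P-path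
  in O , O↭E , λ O′ O′↭E →
       chain-ordering-unique O (ordering-simple tree O↭E) (ordering-acyclic tree O↭E) chain (↭-trans O′↭E (↭-sym O↭E))

theorem3p2 : (n : ℕ) (E : List (Edge (suc n))) → IsTree E →
    (Σ (List (Edge (suc n))) (λ O → IsOrdering E O × IsCycle (product O) × MultiplicityOne E (product O)))
      ⇔ IsCaterpillar E
theorem3p2 n E tree = mk⇔
  (λ (_ , _ , _ , O , O↭E , O-product , unique) →
     unique-product⇒caterpillar tree O↭E λ O′ O′↭E same → unique O′ O′↭E λ x → trans (same x) (O-product x))
  (λ caterpillar → let O , O↭E , unique = caterpillar⇒unique-product tree caterpillar
                   in O , O↭E , tree-ordering-isCycle tree O↭E , O , O↭E , (λ _ → refl) , unique)
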